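{- Let $T$ be a tree with $n\ge 1$ vertices. Then the polytope $P_{n-1}(T)$ is unimodularly equivalent to $[0,1]^{n-1}\times\{0\}\subset\mathbb{R}^n$; that is, there exist $U\in \mathrm{SL}_n(\mathbb{Z})$ and $b\in\mathbb{Z}^n$ with $[0,1]^{n-1}\times\{0\}=U\,P_{n-1}(T)+b$.
   Context: Label the vertices $v_1,\dots,v_n$. A chip configuration on $T$ is a vector $c\in\mathbb{Z}_{\ge 0}^n$ ($c_i$ chips on $v_i$). The Laplacian $\Delta(T)$ has $\Delta_{ii}=\deg(v_i)$, $\Delta_{ij}=-1$ if $v_iv_j$ is an edge, $0$ otherwise. Firing $v_i$ from $c$ produces $c-\Delta(T)e_i$, legal if $c_i\ge\deg(v_i)$. A configuration $c$ is self-reachable on $T$ if some nonempty finite sequence of legal firings starting from $c$ ends at $c$. (Known: equivalently, $c$ has at least $m-1$ chips on every $m$-vertex subtree of $T$.) $S_\ell^{(T)}$ is the set of self-reachable configurations on $T$ with exactly $\ell$ chips, and $P_\ell(T)=\mathrm{conv}(S_\ell^{(T)})\subset\mathbb{R}^n$.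
   Formalization: The polytope $P_{n-1}(T)$ and the cube $[0,1]^{n-1}\times\{0\}$ are taken in ℚ^n instead of ℝ^n. -}

module Defs where

open import Data.Nat as ℕ using (ℕ; zero; suc; _∸_; _≥_)
open import Data.Integer as ℤ using (ℤ; +_)
open import Data.Rational as ℚ using (ℚ; 0ℚ; 1ℚ)
open import Data.Fin using (Fin; zero; suc; toℕ; punchIn)
open import Data.Bool using (Bool; true; false; if_then_else_)
open import Data.List using (List; []; _∷_; length)
open import Data.List.Relation.Unary.All using (All)
open import Data.List.Relation.Unary.Unique.Propositional using (Unique)
open import Data.Product using (Σ; _×_; _,_; ∃)
open import Relation.Binary.PropositionalEquality using (_≡_; _≢_)
open import Relation.Nullary using (¬_)
open import Data.Fin using (_≟_)
open import Relation.Nullary.Decidable using (⌊_⌋)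

sumℕ : ∀ {n} → (Fin n → ℕ) → ℕ
sumℕ {zero}  f = 0
sumℕ {suc n} f = f zero ℕ.+ sumℕ (λ i → f (suc i))

sumℤ : ∀ {n} → (Fin n → ℤ) → ℤ
sumℤ {zero}  f = + 0
sumℤ {suc n} f = f zero ℤ.+ sumℤ (λ i → f (suc i))

sumℚ : ∀ {n} → (Fin n → ℚ) → ℚ
sumℚ {zero}  f = 0ℚ
sumℚ {suc n} f = f zero ℚ.+ sumℚ (λ i → f (suc i))

record Graph (n : ℕ) : Set where
  field
    adj   : Fin n → Fin n → Bool
    sym   : ∀ i j → adj i j ≡ adj j i
    irrefl : ∀ i → adj i i ≡ false
open Graph public

Adj : ∀ {n} → Graph n → Fin n → Fin n → Set
Adj G i j = adj G i j ≡ true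

data Walk {n} (G : Graph n) : Fin n → Fin n → List (Fin n) → Set where
  here : ∀ {v} → Walk G v v (v ∷ [])
  step : ∀ {u v w vs} → Adj G u v → Walk G v w vs → Walk G u w (u ∷ vs)

Connected : ∀ {n} → Graph n → Set
Connected G = ∀ u v → ∃ λ vs → Walk G u v vs

HasCycle : ∀ {n} → Graph n → Set
HasCycle {n} G = Σ (Fin n) λ u → Σ (Fin n) λ v → Σ (List (Fin n)) λ vs →
  Walk G u v vs × Unique vs × (length vs ℕ.≥ 3) × Adj G v u

IsTree : ∀ {n} → Graph n → Set
IsTree G = Connected G × ¬ HasCycle G

Config : ℕ → Set
Config n = Fin n → ℕ

deg : ∀ {n} → Graph n → Fin n → ℕ
deg G i = sumℕ (λ j → if adj G i j then 1 else 0)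

-- c - Δ(T) e_i  (well-defined in ℕ when the firing is legal)
fire : ∀ {n} → Graph n → Config n → Fin n → Config n
fire G c i k =
  if ⌊ k ≟ i ⌋ then c k ∸ deg G i
  else (if adj G i k then suc (c k) else c k)

Legal : ∀ {n} → Graph n → Config n → Fin n → Set
Legal G c i = c i ≥ deg G i

data Fires {n} (G : Graph n) : Config n → Config n → Set where
  done : ∀ {c d} → (∀ k → c k ≡ d k) → Fires G c d
  _∷ₛ_ : ∀ {c d} {i : Fin n} → Legal G c i → Fires G (fire G c i) d → Fires G c d

SelfReachable : ∀ {n} → Graph n → Config n → Set
SelfReachable G c = Σ _ λ i → Legal G c i × Fires G (fire G c i) c

S : ∀ {n} → Graph n → ℕ → Config n → Set
S G ℓ c = SelfReachable G c × sumℕ c ≡ ℓ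

ℕtoℚ : ℕ → ℚ
ℕtoℚ m = (+ m) ℚ./ 1

ℤtoℚ : ℤ → ℚ
ℤtoℚ z = z ℚ./ 1

InConv : ∀ {n} → (Config n → Set) → (Fin n → ℚ) → Set
InConv {n} A x = Σ ℕ λ m → Σ (Fin m → ℚ) λ λs → Σ (Fin m → Config n) λ pts →
    (∀ j → 0ℚ ℚ.≤ λs j)
  × (sumℚ λs ≡ 1ℚ)
  × (∀ j → A (pts j))
  × (∀ k → x k ≡ sumℚ (λ j → λs j ℚ.* ℕtoℚ (pts j k)))

P : ∀ {n} → Graph n → ℕ → (Fin n → ℚ) → Set
P G ℓ = InConv (S G ℓ)

Mat : ℕ → Set
Mat n = Fin n → Fin n → ℤ

minor : ∀ {n} → Mat (suc n) → Fin (suc n) → Mat n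
minor M j r c = M (suc r) (punchIn j c)

sign : ℕ → ℤ
sign zero = + 1
sign (suc zero) = ℤ.- (+ 1)
sign (suc (suc k)) = sign k

det : ∀ {n} → Mat n → ℤ
det {zero}  M = + 1
det {suc n} M = sumℤ (λ j → sign (toℕ j) ℤ.* (M zero j ℤ.* det (minor M j)))

affine : ∀ {n} → Mat n → (Fin n → ℤ) → (Fin n → ℚ) → (Fin n → ℚ)
affine U b x i = sumℚ (λ j → ℤtoℚ (U i j) ℚ.* x j) ℚ.+ ℤtoℚ (b i)

CubeTimesZero : ∀ m → (Fin (suc m) → ℚ) → Set
CubeTimesZero m y = ∀ i →
  (toℕ i ℕ.< m → (0ℚ ℚ.≤ y i × y i ℚ.≤ 1ℚ)) × (toℕ i ≡ m → y i ≡ 0ℚ)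

{-# OPTIONS --safe #-}
-- Induction on the number of vertices, removing a leaf j with neighbour p.  Contracting the edge jp
-- (merging the chips of j and p and discarding one) maps S_{n-1}(T) into S_{n-2}(T − j): it simulates
-- firing sequences, and the edge jp always carries a chip because p fires in every returning sequence.
-- Conversely every configuration of S_{n-2}(T − j) lifts to S_{n-1}(T) with either 0 or 1 chip on j,
-- and no configuration of S_{n-1}(T) has more than deg j = 1 chip on j.  So in the coordinates
-- (x_j, contraction of x) the polytope P_{n-1}(T) is the prism [0,1] × P_{n-2}(T − j), and the
-- unimodular map for T − j extends by a row reading off x_j, reflected to 1 − x_j when that is needed
-- to keep the determinant 1.
module Submission where

open import Defs hiding (sym)
open import Algebra.Bundles using (CommutativeRing)
import Algebra.Properties.CommutativeMonoid.Sum as CommutativeMonoidSum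
import Algebra.Properties.Semiring.Sum as SemiringSum
open import Data.Bool using (Bool; true; false; if_then_else_)
import Data.Bool.Properties as BoolP
open import Data.Empty using (⊥; ⊥-elim)
open import Data.Fin as F using (Fin; zero; suc; toℕ; punchIn; punchOut)
import Data.Fin.Properties as FP
open import Data.Integer as ℤ using (ℤ; +_)
import Data.Integer.Properties as ℤP
open import Data.List using (List; []; _∷_; length; map; lookup)
import Data.List.Properties as ListP
open import Data.List.Membership.Propositional using (_∈_; _∉_)
open import Data.List.Membership.Propositional.Properties using (∈-lookup)
open import Data.List.Relation.Unary.All as All using (All; []; _∷_)
open import Data.List.Relation.Unary.All.Properties.Core using (¬Any⇒All¬)
open import Data.List.Relation.Unary.Any using (here; there)
open import Data.List.Relation.Unary.Unique.Propositional using (Unique; []; _∷_)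
import Data.List.Relation.Unary.Unique.Propositional.Properties as UniqueP
open import Data.Nat as ℕ using (ℕ; zero; suc; _∸_; _≤_; _<_; z≤n; s≤s)
import Data.Nat.Properties as ℕP
open import Data.Product using (Σ; ∃; ∃-syntax; _×_; _,_; proj₁; proj₂)
open import Data.Rational as ℚ using (ℚ; 0ℚ; 1ℚ)
import Data.Rational.Properties as ℚP
open import Data.Rational.Solver using (module +-*-Solver)
import Data.Rational.Unnormalised as ℚᵘ
import Data.Rational.Unnormalised.Properties as ℚᵘP
open import Data.Sum using (_⊎_; inj₁; inj₂)
open import Data.Vec.Functional using (insertAt; removeAt; updateAt; zipWith; _++_)
import Data.Vec.Functional.Properties as VP
open import Data.Vec.Functional.Relation.Unary.All.Properties using (++⁺)
open import Function using (_∘_)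
open import Relation.Nullary using (¬_; Dec; yes; no; ¬?)
open import Relation.Nullary.Decidable using (⌊_⌋; _×-dec_)
open import Relation.Binary.PropositionalEquality

open +-*-Solver

module ℕΣ = CommutativeMonoidSum ℕP.+-0-commutativeMonoid
module ℤΣ = CommutativeMonoidSum ℤP.+-0-commutativeMonoid
module ℚΣ = SemiringSum (CommutativeRing.semiring ℚP.+-*-commutativeRing)

sumℕ≡sum : ∀ {n} (f : Fin n → ℕ) → sumℕ f ≡ ℕΣ.sum f
sumℕ≡sum {zero}  f = refl
sumℕ≡sum {suc n} f = cong (f zero ℕ.+_) (sumℕ≡sum (f ∘ suc))

sumℤ≡sum : ∀ {n} (f : Fin n → ℤ) → sumℤ f ≡ ℤΣ.sum f
sumℤ≡sum {zero}  f = refl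
sumℤ≡sum {suc n} f = cong (ℤ._+_ (f zero)) (sumℤ≡sum (f ∘ suc))

sumℚ≡sum : ∀ {n} (f : Fin n → ℚ) → sumℚ f ≡ ℚΣ.sum f
sumℚ≡sum {zero}  f = refl
sumℚ≡sum {suc n} f = cong (f zero ℚ.+_) (sumℚ≡sum (f ∘ suc))

sumℕ-cong : ∀ {n} {f g : Fin n → ℕ} → f ≗ g → sumℕ f ≡ sumℕ g
sumℕ-cong {f = f} {g} f≗g = trans (sumℕ≡sum f) (trans (ℕΣ.sum-cong-≗ {x = f} {y = g} f≗g) (sym (sumℕ≡sum g)))

sumℕ-removeAt : ∀ {n} (f : Fin (suc n) → ℕ) i → sumℕ f ≡ f i ℕ.+ sumℕ (removeAt f i)
sumℕ-removeAt f i = trans (sumℕ≡sum f) (trans (ℕΣ.sum-remove {i = i} f) (cong (f i ℕ.+_) (sym (sumℕ≡sum (removeAt f i)))))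

sumℕ-zero : ∀ {n} {f : Fin n → ℕ} → f ≗ (λ _ → 0) → sumℕ f ≡ 0
sumℕ-zero {n} f≗0 = trans (sumℕ-cong f≗0) (trans (sumℕ≡sum {n} (λ _ → 0)) (ℕΣ.sum-replicate-zero n))

sumℤ-cong : ∀ {n} {f g : Fin n → ℤ} → f ≗ g → sumℤ f ≡ sumℤ g
sumℤ-cong {f = f} {g} f≗g = trans (sumℤ≡sum f) (trans (ℤΣ.sum-cong-≗ {x = f} {y = g} f≗g) (sym (sumℤ≡sum g)))

sumℤ-removeAt : ∀ {n} (f : Fin (suc n) → ℤ) i → sumℤ f ≡ f i ℤ.+ sumℤ (removeAt f i)
sumℤ-removeAt f i = trans (sumℤ≡sum f) (trans (ℤΣ.sum-remove {i = i} f) (cong (ℤ._+_ (f i)) (sym (sumℤ≡sum (removeAt f i)))))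

sumℤ-zero : ∀ {n} {f : Fin n → ℤ} → f ≗ (λ _ → + 0) → sumℤ f ≡ + 0
sumℤ-zero {n} f≗0 = trans (sumℤ-cong f≗0) (trans (sumℤ≡sum {n} (λ _ → + 0)) (ℤΣ.sum-replicate-zero n))

sumℚ-cong : ∀ {n} {f g : Fin n → ℚ} → f ≗ g → sumℚ f ≡ sumℚ g
sumℚ-cong {f = f} {g} f≗g = trans (sumℚ≡sum f) (trans (ℚΣ.sum-cong-≗ {x = f} {y = g} f≗g) (sym (sumℚ≡sum g)))

sumℚ-removeAt : ∀ {n} (f : Fin (suc n) → ℚ) i → sumℚ f ≡ f i ℚ.+ sumℚ (removeAt f i)
sumℚ-removeAt f i = trans (sumℚ≡sum f) (trans (ℚΣ.sum-remove {i = i} f) (cong (f i ℚ.+_) (sym (sumℚ≡sum (removeAt f i)))))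

sumℚ-zero : ∀ {n} {f : Fin n → ℚ} → f ≗ (λ _ → 0ℚ) → sumℚ f ≡ 0ℚ
sumℚ-zero {n} f≗0 = trans (sumℚ-cong f≗0) (trans (sumℚ≡sum {n} (λ _ → 0ℚ)) (ℚΣ.sum-replicate-zero n))

sumℚ-distrib-+ : ∀ {n} (f g : Fin n → ℚ) → sumℚ (λ k → f k ℚ.+ g k) ≡ sumℚ f ℚ.+ sumℚ g
sumℚ-distrib-+ f g = trans (sumℚ≡sum (λ k → f k ℚ.+ g k)) (trans (ℚΣ.∑-distrib-+ f g) (sym (cong₂ ℚ._+_ (sumℚ≡sum f) (sumℚ≡sum g))))

*-distribˡ-sumℚ : ∀ {n} x (f : Fin n → ℚ) → x ℚ.* sumℚ f ≡ sumℚ (λ k → x ℚ.* f k)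
*-distribˡ-sumℚ x f = trans (cong (x ℚ.*_) (sumℚ≡sum f)) (trans (ℚΣ.*-distribˡ-sum x f) (sym (sumℚ≡sum (λ k → x ℚ.* f k))))

sumℚ-++ : ∀ {m n} (f : Fin m → ℚ) (g : Fin n → ℚ) → sumℚ (f ++ g) ≡ sumℚ f ℚ.+ sumℚ g
sumℚ-++ {zero}  f g = sym (ℚP.+-identityˡ (sumℚ g))
sumℚ-++ {suc m} f g =
  trans (cong (f zero ℚ.+_) (trans (sumℚ-cong ++-suc) (sumℚ-++ (f ∘ suc) g))) (sym (ℚP.+-assoc (f zero) _ _))
  where
  ++-suc : ∀ i → (f ++ g) (suc i) ≡ ((f ∘ suc) ++ g) i
  ++-suc i with F.splitAt m i
  ... | inj₁ _ = refl
  ... | inj₂ _ = refl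

sumℚ-mono-≤ : ∀ {n} {f g : Fin n → ℚ} → (∀ k → f k ℚ.≤ g k) → sumℚ f ℚ.≤ sumℚ g
sumℚ-mono-≤ {zero}  f≤g = ℚP.≤-refl
sumℚ-mono-≤ {suc n} f≤g = ℚP.+-mono-≤ (f≤g zero) (sumℚ-mono-≤ (f≤g ∘ suc))

sumℕ-updateAt : ∀ {n} (f : Fin (suc n) → ℕ) i g → sumℕ (updateAt f i g) ≡ g (f i) ℕ.+ sumℕ (removeAt f i)
sumℕ-updateAt f i g = trans (sumℕ-removeAt (updateAt f i g) i)
  (cong₂ ℕ._+_ (VP.updateAt-updates i f) (sumℕ-cong (λ k → VP.updateAt-minimal (punchIn i k) i f (FP.punchInᵢ≢i i k))))

sumℕ-insertAt : ∀ {n} (f : Fin n → ℕ) i x → sumℕ (insertAt f i x) ≡ x ℕ.+ sumℕ f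
sumℕ-insertAt f i x = trans (sumℕ-removeAt (insertAt f i x) i)
  (cong₂ ℕ._+_ (VP.insertAt-lookup f i x) (sumℕ-cong (VP.removeAt-insertAt f i x)))

_∈[0,1] : ℚ → Set
t ∈[0,1] = 0ℚ ℚ.≤ t × t ℚ.≤ 1ℚ

0≤1 : 0ℚ ℚ.≤ 1ℚ
0≤1 = ℚP.nonNegative⁻¹ 1ℚ

0∈[0,1] : 0ℚ ∈[0,1]
0∈[0,1] = ℚP.≤-refl , 0≤1

1∈[0,1] : 1ℚ ∈[0,1]
1∈[0,1] = 0≤1 , ℚP.≤-refl

1-‿∈[0,1] : ∀ {t} → t ∈[0,1] → (1ℚ ℚ.- t) ∈[0,1]
1-‿∈[0,1] {t} (0≤t , t≤1) =
  ℚP.≤-trans (ℚP.≤-reflexive (sym (ℚP.+-inverseʳ 1ℚ))) (ℚP.+-monoʳ-≤ 1ℚ (ℚP.neg-antimono-≤ t≤1)) ,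
  ℚP.≤-trans (ℚP.+-monoʳ-≤ 1ℚ (ℚP.neg-antimono-≤ 0≤t)) (ℚP.≤-reflexive (ℚP.+-identityʳ 1ℚ))

*-nonNeg : ∀ {a b} → 0ℚ ℚ.≤ a → 0ℚ ℚ.≤ b → 0ℚ ℚ.≤ a ℚ.* b
*-nonNeg {a} {b} 0≤a 0≤b =
  ℚP.nonNegative⁻¹ (a ℚ.* b) {{ℚP.nonNeg*nonNeg⇒nonNeg a {{ℚ.nonNegative 0≤a}} b {{ℚ.nonNegative 0≤b}}}}

p*q≤p : ∀ {a t} → 0ℚ ℚ.≤ a → t ℚ.≤ 1ℚ → a ℚ.* t ℚ.≤ a
p*q≤p {a} 0≤a t≤1 =
  ℚP.≤-trans (ℚP.*-monoˡ-≤-nonNeg a {{ℚ.nonNegative 0≤a}} t≤1) (ℚP.≤-reflexive (ℚP.*-identityʳ a))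

weighted : ∀ {m} → (Fin m → ℚ) → (Fin m → ℚ) → ℚ
weighted w f = sumℚ (λ k → w k ℚ.* f k)

ConvexWeights : ∀ {m} → (Fin m → ℚ) → Set
ConvexWeights w = (∀ k → 0ℚ ℚ.≤ w k) × sumℚ w ≡ 1ℚ

weighted-+ : ∀ {m} (w f g : Fin m → ℚ) → weighted w (λ k → f k ℚ.+ g k) ≡ weighted w f ℚ.+ weighted w g
weighted-+ w f g = trans (sumℚ-cong (λ k → ℚP.*-distribˡ-+ (w k) (f k) (g k))) (sumℚ-distrib-+ (λ k → w k ℚ.* f k) (λ k → w k ℚ.* g k))

weighted-scale : ∀ {m} c (w f : Fin m → ℚ) → weighted (λ k → c ℚ.* w k) f ≡ c ℚ.* weighted w f
weighted-scale c w f = trans (sumℚ-cong (λ k → ℚP.*-assoc c (w k) (f k))) (sym (*-distribˡ-sumℚ c (λ k → w k ℚ.* f k)))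

weighted-const : ∀ {m} (w : Fin m → ℚ) c → sumℚ w ≡ 1ℚ → weighted w (λ _ → c) ≡ c
weighted-const w c ∑w≡1 = begin
  sumℚ (λ k → w k ℚ.* c)  ≡⟨ sumℚ-cong (λ k → ℚP.*-comm (w k) c) ⟩
  sumℚ (λ k → c ℚ.* w k)  ≡⟨ *-distribˡ-sumℚ c w ⟨
  c ℚ.* sumℚ w            ≡⟨ cong (c ℚ.*_) ∑w≡1 ⟩
  c ℚ.* 1ℚ                ≡⟨ ℚP.*-identityʳ c ⟩
  c                       ∎
  where open ≡-Reasoning

weighted-+const : ∀ {m} (w : Fin m → ℚ) f c → sumℚ w ≡ 1ℚ → weighted w (λ k → f k ℚ.+ c) ≡ weighted w f ℚ.+ c
weighted-+const w f c ∑w≡1 = trans (weighted-+ w f (λ _ → c)) (cong (weighted w f ℚ.+_) (weighted-const w c ∑w≡1))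

map-++ : ∀ {A B : Set} {m n} (h : A → B) (f : Fin m → A) (g : Fin n → A) → ∀ i → h ((f ++ g) i) ≡ ((h ∘ f) ++ (h ∘ g)) i
map-++ {m = m} h f g i with F.splitAt m i
... | inj₁ _ = refl
... | inj₂ _ = refl

weighted-++ : ∀ {m n} (w : Fin m → ℚ) (v : Fin n → ℚ) f g → weighted (w ++ v) (f ++ g) ≡ weighted w f ℚ.+ weighted v g
weighted-++ {m} w v f g = trans (sumℚ-cong zipWith-++) (sumℚ-++ (zipWith ℚ._*_ w f) (zipWith ℚ._*_ v g))
  where
  zipWith-++ : ∀ i → (w ++ v) i ℚ.* (f ++ g) i ≡ (zipWith ℚ._*_ w f ++ zipWith ℚ._*_ v g) i
  zipWith-++ i with F.splitAt m i
  ... | inj₁ _ = refl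
  ... | inj₂ _ = refl

weighted-∈[0,1] : ∀ {m} {w f : Fin m → ℚ} → ConvexWeights w → (∀ k → f k ∈[0,1]) → weighted w f ∈[0,1]
weighted-∈[0,1] {m} {w} {f} (w≥0 , ∑w≡1) f∈[0,1] =
  ℚP.≤-trans (ℚP.≤-reflexive (sym (sumℚ-zero {m} (λ _ → refl))))
             (sumℚ-mono-≤ (λ k → *-nonNeg (w≥0 k) (proj₁ (f∈[0,1] k)))) ,
  ℚP.≤-trans (sumℚ-mono-≤ (λ k → p*q≤p (w≥0 k) (proj₂ (f∈[0,1] k)))) (ℚP.≤-reflexive ∑w≡1)

InConv-cong : ∀ {n} {A : Config n → Set} {x y} → (∀ k → x k ≡ y k) → InConv A x → InConv A y
InConv-cong x≗y (m , w , pts , w≥0 , ∑w≡1 , pts∈A , x≡) =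
  m , w , pts , w≥0 , ∑w≡1 , pts∈A , λ k → trans (sym (x≗y k)) (x≡ k)

InConv-convex : ∀ {n} {A : Config n → Set} {x y t} → InConv A x → InConv A y → t ∈[0,1] →
  InConv A (λ k → (1ℚ ℚ.- t) ℚ.* x k ℚ.+ t ℚ.* y k)
InConv-convex {A = A} {x} {y} {t} (m , w , pts , w≥0 , ∑w≡1 , pts∈A , x≡) (m′ , v , qts , v≥0 , ∑v≡1 , qts∈A , y≡) t∈[0,1] =
  m ℕ.+ m′ , wv , pts ++ qts ,
  ++⁺ (0ℚ ℚ.≤_) (λ k → *-nonNeg (proj₁ (1-‿∈[0,1] t∈[0,1])) (w≥0 k)) (λ k → *-nonNeg (proj₁ t∈[0,1]) (v≥0 k)) ,
  ∑wv≡1 , ++⁺ A pts∈A qts∈A , mix≡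
  where
  wv : Fin (m ℕ.+ m′) → ℚ
  wv = (λ k → (1ℚ ℚ.- t) ℚ.* w k) ++ (λ k → t ℚ.* v k)
  ∑wv≡1 : sumℚ wv ≡ 1ℚ
  ∑wv≡1 = begin
    sumℚ wv                                                        ≡⟨ sumℚ-++ (λ k → (1ℚ ℚ.- t) ℚ.* w k) (λ k → t ℚ.* v k) ⟩
    sumℚ (λ k → (1ℚ ℚ.- t) ℚ.* w k) ℚ.+ sumℚ (λ k → t ℚ.* v k)    ≡⟨ cong₂ ℚ._+_ (*-distribˡ-sumℚ (1ℚ ℚ.- t) w) (*-distribˡ-sumℚ t v) ⟨
    (1ℚ ℚ.- t) ℚ.* sumℚ w ℚ.+ t ℚ.* sumℚ v                         ≡⟨ cong₂ (λ a b → (1ℚ ℚ.- t) ℚ.* a ℚ.+ t ℚ.* b) ∑w≡1 ∑v≡1 ⟩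
    (1ℚ ℚ.- t) ℚ.* 1ℚ ℚ.+ t ℚ.* 1ℚ                                 ≡⟨ solve 1 (λ t → (con 1ℚ :- t) :* con 1ℚ :+ t :* con 1ℚ := con 1ℚ) refl t ⟩
    1ℚ                                                             ∎
    where open ≡-Reasoning
  mix≡ : ∀ k → (1ℚ ℚ.- t) ℚ.* x k ℚ.+ t ℚ.* y k ≡ weighted wv (λ i → ℕtoℚ ((pts ++ qts) i k))
  mix≡ k = sym (begin
    weighted wv (λ i → ℕtoℚ ((pts ++ qts) i k))            ≡⟨ sumℚ-cong (λ i → cong (wv i ℚ.*_) (map-++ (λ p → ℕtoℚ (p k)) pts qts i)) ⟩
    weighted wv (ptsₖ ++ qtsₖ)                              ≡⟨ weighted-++ (λ k → (1ℚ ℚ.- t) ℚ.* w k) (λ k → t ℚ.* v k) ptsₖ qtsₖ ⟩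
    weighted (λ k → (1ℚ ℚ.- t) ℚ.* w k) ptsₖ ℚ.+ weighted (λ k → t ℚ.* v k) qtsₖ
                                                           ≡⟨ cong₂ ℚ._+_ (weighted-scale (1ℚ ℚ.- t) w ptsₖ) (weighted-scale t v qtsₖ) ⟩
    (1ℚ ℚ.- t) ℚ.* weighted w ptsₖ ℚ.+ t ℚ.* weighted v qtsₖ ≡⟨ cong₂ (λ a b → (1ℚ ℚ.- t) ℚ.* a ℚ.+ t ℚ.* b) (x≡ k) (y≡ k) ⟨
    (1ℚ ℚ.- t) ℚ.* x k ℚ.+ t ℚ.* y k                        ∎)
    where
    open ≡-Reasoning
    ptsₖ : Fin m → ℚ
    ptsₖ i = ℕtoℚ (pts i k)
    qtsₖ : Fin m′ → ℚ
    qtsₖ i = ℕtoℚ (qts i k)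

Adj-sym : ∀ {n} (G : Graph n) {u v} → Adj G u v → Adj G v u
Adj-sym G {u} {v} uv = trans (Graph.sym G v u) uv

Adj-irrefl : ∀ {n} (G : Graph n) {u} → ¬ Adj G u u
Adj-irrefl G {u} uu with trans (sym uu) (irrefl G u)
... | ()

Adj? : ∀ {n} (G : Graph n) u v → Dec (Adj G u v)
Adj? G u v = adj G u v BoolP.≟ true

lookup-injective : ∀ {A : Set} {xs : List A} → Unique xs → ∀ {i j} → lookup xs i ≡ lookup xs j → i ≡ j
lookup-injective (x∉xs ∷ _)  {zero}  {zero}  _ = refl
lookup-injective (x∉xs ∷ _)  {zero}  {suc j} x≡ = ⊥-elim (All.lookup x∉xs (∈-lookup j) x≡)
lookup-injective (x∉xs ∷ _)  {suc i} {zero}  ≡x = ⊥-elim (All.lookup x∉xs (∈-lookup i) (sym ≡x))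
lookup-injective (_ ∷ uniq) {suc i} {suc j} eq = cong suc (lookup-injective uniq eq)

Unique⇒length≤ : ∀ {n} {xs : List (Fin n)} → Unique xs → length xs ≤ n
Unique⇒length≤ uniq = FP.injective⇒≤ (lookup-injective uniq)

module _ {n} (G : Graph n) where

  Walk-end∈ : ∀ {u v vs} → Walk G u v vs → v ∈ vs
  Walk-end∈ here       = here refl
  Walk-end∈ (step _ W) = there (Walk-end∈ W)

  Walk-nonempty : ∀ {u v vs} → Walk G u v vs → 1 ≤ length vs
  Walk-nonempty here       = s≤s z≤n
  Walk-nonempty (step _ _) = s≤s z≤n

  Walk-prefix : ∀ {u v w vs} → Walk G u v vs → w ∈ vs →
    ∃[ ys ] Walk G u w ys × (∀ {z} → z ∈ ys → z ∈ vs) × (Unique vs → Unique ys)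
  Walk-prefix here       (here refl) = _ , here , (λ z∈ → z∈) , (λ uniq → uniq)
  Walk-prefix (step _ _) (here refl) = _ , here , (λ { (here refl) → here refl }) , (λ _ → [] ∷ [])
  Walk-prefix {u} (step {vs = vs} uz W) (there w∈) with Walk-prefix W w∈
  ... | ys , W′ , ys⊆ , uniq⇒ = u ∷ ys , step uz W′ , ∷⊆ , ∷uniq
    where
    ∷⊆ : ∀ {z} → z ∈ u ∷ ys → z ∈ u ∷ vs
    ∷⊆ (here z≡u)  = here z≡u
    ∷⊆ (there z∈) = there (ys⊆ z∈)
    ∷uniq : Unique (u ∷ vs) → Unique (u ∷ ys)
    ∷uniq (u∉ ∷ uniq) = All.tabulate (All.lookup u∉ ∘ ys⊆) ∷ uniq⇒ uniq

  -- The prefix q, …, u of the path would close the cycle w, q, …, u.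
  acyclic-no-chord : ¬ HasCycle G → ∀ {w q v u vs} → Adj G w q → Walk G q v vs → All (w ≢_) vs → Unique vs →
    u ∈ vs → Adj G w u → u ≡ q
  acyclic-no-chord acyclic wq W w∉ uniq u∈ wu with Walk-prefix W u∈
  ... | _ , here , _ , _ = refl
  ... | _ , step {w = u} qz W′ , ys⊆ , uniq⇒ =
    ⊥-elim (acyclic (_ , u , _ , step wq (step qz W′) ,
      All.tabulate (All.lookup w∉ ∘ ys⊆) ∷ uniq⇒ uniq , s≤s (s≤s (Walk-nonempty W′)) , Adj-sym G wu))

  open import Data.List.Membership.DecPropositional (FP._≟_ {n}) using (_∈?_)

  -- The fuel bounds the number of extensions, since a path has at most n vertices.
  extend-to-maximal-path : ∀ fuel {w v vs} → Walk G w v vs → Unique vs → n ≤ length vs ℕ.+ fuel →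
    ∃[ w′ ] ∃[ vs′ ] Walk G w′ v vs′ × Unique vs′ × (∀ {u} → Adj G w′ u → u ∈ vs′)
  extend-to-maximal-path fuel {w} {v} {vs} W uniq n≤ with FP.any? (λ u → Adj? G w u ×-dec ¬? (u ∈? vs))
  ... | no stuck = w , vs , W , uniq , closed
    where
    closed : ∀ {u} → Adj G w u → u ∈ vs
    closed {u} wu with u ∈? vs
    ... | yes u∈ = u∈
    ... | no u∉  = ⊥-elim (stuck (u , wu , u∉))
  ... | yes (u , wu , u∉) with uniq′ ← ¬Any⇒All¬ vs u∉ ∷ uniq | fuel
  ...   | zero      = ⊥-elim (ℕP.<-irrefl refl
                        (ℕP.≤-trans (Unique⇒length≤ uniq′) (ℕP.≤-trans n≤ (ℕP.≤-reflexive (ℕP.+-identityʳ (length vs))))))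
  ...   | suc fuel′ = extend-to-maximal-path fuel′ (step (Adj-sym G wu) W) uniq′
                        (ℕP.≤-trans n≤ (ℕP.≤-reflexive (ℕP.+-suc (length vs) fuel′)))

removeVertex : ∀ {n} → Graph (suc n) → Fin (suc n) → Graph n
removeVertex G j = record
  { adj    = λ a b → adj G (punchIn j a) (punchIn j b)
  ; sym    = λ a b → Graph.sym G (punchIn j a) (punchIn j b)
  ; irrefl = λ a → irrefl G (punchIn j a)
  }

-- The neighbour of the leaf is recorded by its index in the graph with the leaf removed.
record Leaf {n} (G : Graph (suc n)) : Set where
  field
    vertex        : Fin (suc n)
    neighbour     : Fin n
    adj-neighbour : Adj G vertex (punchIn vertex neighbour)
    adj-unique    : ∀ {u} → Adj G vertex u → u ≡ punchIn vertex neighbour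

mkLeaf : ∀ {n} (G : Graph (suc n)) {j q} → Adj G j q → (∀ {u} → Adj G j u → u ≡ q) → Leaf G
mkLeaf G {j} {q} jq unique = record
  { vertex        = j
  ; neighbour     = punchOut j≢q
  ; adj-neighbour = subst (Adj G j) (sym (FP.punchIn-punchOut j≢q)) jq
  ; adj-unique    = λ ju → trans (unique ju) (sym (FP.punchIn-punchOut j≢q))
  }
  where
  j≢q : j ≢ q
  j≢q refl = Adj-irrefl G jq

another : ∀ {n} (v : Fin (suc (suc n))) → ∃[ u ] u ≢ v
another zero    = suc zero , λ ()
another (suc _) = zero , λ ()

-- The far end of a maximal path ending at v is a leaf, unless the path is v alone, which would make v isolated.
tree-has-leaf-avoiding : ∀ {n} (G : Graph (suc (suc n))) → IsTree G → ∀ v → Σ (Leaf G) λ L → Leaf.vertex L ≢ v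
tree-has-leaf-avoiding {n} G (connected , acyclic) v
  with extend-to-maximal-path G (suc (suc n)) here ([] ∷ []) (ℕP.m≤n+m _ 1)
... | w , _ , step {v = q} wq W , w∉ ∷ uniq , closed = mkLeaf G wq unique , λ w≡v → All.lookup w∉ (Walk-end∈ G W) w≡v
  where
  unique : ∀ {u} → Adj G w u → u ≡ q
  unique wu with closed wu
  ... | here refl = ⊥-elim (Adj-irrefl G wu)
  ... | there u∈  = acyclic-no-chord G acyclic wq W w∉ uniq u∈ wu
... | _ , _ , here , _ , closed with another v
...   | v₂ , v₂≢v with connected v v₂
...     | _ , here        = ⊥-elim (v₂≢v refl)
...     | _ , step vz _ with closed vz
...       | here refl = ⊥-elim (Adj-irrefl G vz)
...       | there ()

data PunchInView {n} (j : Fin (suc n)) : Fin (suc n) → Set where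
  at      : PunchInView j j
  punched : ∀ a → PunchInView j (punchIn j a)

punchInView : ∀ {n} (j k : Fin (suc n)) → PunchInView j k
punchInView j k with k F.≟ j
... | yes refl = at
... | no k≢j   = subst (PunchInView j) (FP.punchIn-punchOut (k≢j ∘ sym)) (punched _)

split-at : ∀ {n ℓ} (i : Fin n) {Q : Fin n → Set ℓ} → Q i → (∀ {b} → b ≢ i → Q b) → ∀ b → Q b
split-at i at-i away b with b F.≟ i
... | yes refl = at-i
... | no b≢i   = away b≢i

module LeafCoordinates {n} (j : Fin (suc (suc n))) (p′ : Fin (suc n)) where

  p : Fin (suc (suc n))
  p = punchIn j p′

  p≢j : p ≢ j
  p≢j = FP.punchInᵢ≢i j p′

  by-coordinate : ∀ {ℓ} {Q : Fin (suc (suc n)) → Set ℓ} → Q j → Q p → (∀ {a} → a ≢ p′ → Q (punchIn j a)) → ∀ k → Q k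
  by-coordinate {Q = Q} at-j at-p away k with punchInView j k
  ... | at        = at-j
  ... | punched a = split-at p′ {Q = λ a → Q (punchIn j a)} at-p away a

Acyclic-removeVertex : ∀ {n} (G : Graph (suc n)) j → ¬ HasCycle G → ¬ HasCycle (removeVertex G j)
Acyclic-removeVertex G j acyclic (u , v , vs , W , uniq , 3≤ , vu) =
  acyclic (punchIn j u , punchIn j v , map (punchIn j) vs , Walk-map W ,
           UniqueP.map⁺ (FP.punchIn-injective j _ _) uniq , subst (3 ≤_) (sym (ListP.length-map _ vs)) 3≤ , vu)
  where
  Walk-map : ∀ {a b as} → Walk (removeVertex G j) a b as → Walk G (punchIn j a) (punchIn j b) (map (punchIn j) as)
  Walk-map here       = here
  Walk-map (step e W) = step e (Walk-map W)

indicator : Bool → ℕ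
indicator b = if b then 1 else 0

deg-removeVertex : ∀ {n} (G : Graph (suc n)) j a →
  deg G (punchIn j a) ≡ indicator (adj G (punchIn j a) j) ℕ.+ deg (removeVertex G j) a
deg-removeVertex G j a = sumℕ-removeAt (indicator ∘ adj G (punchIn j a)) j

module LeafRemoval {n} {G : Graph (suc (suc n))} (L : Leaf G) where
  open Leaf L public renaming (vertex to j; neighbour to p′)
  open LeafCoordinates j p′ public

  T′ : Graph (suc n)
  T′ = removeVertex G j

  ¬adj-j : ∀ {u} → u ≢ p → adj G j u ≡ false
  ¬adj-j {u} u≢p with adj G j u in ju
  ... | true  = ⊥-elim (u≢p (adj-unique ju))
  ... | false = refl

  ¬adj-to-j : ∀ {a} → a ≢ p′ → adj G (punchIn j a) j ≡ false
  ¬adj-to-j {a} a≢p′ = trans (Graph.sym G (punchIn j a) j) (¬adj-j (a≢p′ ∘ FP.punchIn-injective j a p′))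

  deg-leaf : deg G j ≡ 1
  deg-leaf = trans (sumℕ-removeAt (indicator ∘ adj G j) p)
    (cong₂ ℕ._+_ (cong indicator adj-neighbour) (sumℕ-zero (λ k → cong indicator (¬adj-j (FP.punchInᵢ≢i p k)))))

  deg-neighbour : deg G p ≡ suc (deg T′ p′)
  deg-neighbour = trans (deg-removeVertex G j p′) (cong (λ b → indicator b ℕ.+ deg T′ p′) (Adj-sym G adj-neighbour))

  deg-other : ∀ {a} → a ≢ p′ → deg G (punchIn j a) ≡ deg T′ a
  deg-other {a} a≢p′ = trans (deg-removeVertex G j a) (cong (λ b → indicator b ℕ.+ deg T′ a) (¬adj-to-j a≢p′))

  -- A walk between vertices other than j can only visit j as a detour p, j, p, which is cut out.
  Walk-removeLeaf : ∀ {x y xs} → Walk G x y xs → ∀ {a b} → x ≡ punchIn j a → y ≡ punchIn j b → ∃ (Walk T′ a b)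
  Walk-removeLeaf here refl y≡ rewrite FP.punchIn-injective j _ _ y≡ = _ , here
  Walk-removeLeaf (step {v = z} xz W) x≡ y≡ with punchInView j z
  ... | punched c = _ , step (subst (λ x → Adj G x (punchIn j c)) x≡ xz) (proj₂ (Walk-removeLeaf W refl y≡))
  ... | at with W
  ...   | here      = ⊥-elim (FP.punchInᵢ≢i j _ (sym y≡))
  ...   | step jz W′ = Walk-removeLeaf W′ (trans (adj-unique jz) (sym (trans (sym x≡) (adj-unique (Adj-sym G xz))))) y≡

  IsTree-removeLeaf : IsTree G → IsTree T′
  IsTree-removeLeaf (connected , acyclic) =
    (λ a b → Walk-removeLeaf (proj₂ (connected (punchIn j a) (punchIn j b))) refl refl) ,
    Acyclic-removeVertex G j acyclic

⌊≟⌋-refl : ∀ {n} (k : Fin n) → ⌊ k F.≟ k ⌋ ≡ true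
⌊≟⌋-refl k with k F.≟ k
... | yes _  = refl
... | no k≢k = ⊥-elim (k≢k refl)

⌊≟⌋-≢ : ∀ {n} {k i : Fin n} → k ≢ i → ⌊ k F.≟ i ⌋ ≡ false
⌊≟⌋-≢ {k = k} {i} k≢i with k F.≟ i
... | yes k≡i = ⊥-elim (k≢i k≡i)
... | no _    = refl

module Firing {n} (G : Graph n) where

  fire-self : ∀ c i → fire G c i i ≡ c i ∸ deg G i
  fire-self c i = cong (λ b → if b then c i ∸ deg G i else (if adj G i i then suc (c i) else c i)) (⌊≟⌋-refl i)

  fire-other : ∀ c {i k} → k ≢ i → fire G c i k ≡ (if adj G i k then suc (c k) else c k)
  fire-other c {i} {k} k≢i = cong (λ b → if b then c k ∸ deg G i else (if adj G i k then suc (c k) else c k)) (⌊≟⌋-≢ k≢i)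

  fire-adj : ∀ c {i k} → k ≢ i → Adj G i k → fire G c i k ≡ suc (c k)
  fire-adj c k≢i ik = trans (fire-other c k≢i) (cong (λ b → if b then suc (c _) else c _) ik)

  fire-¬adj : ∀ c {i k} → k ≢ i → adj G i k ≡ false → fire G c i k ≡ c k
  fire-¬adj c k≢i ¬ik = trans (fire-other c k≢i) (cong (λ b → if b then suc (c _) else c _) ¬ik)

  fire-mono : ∀ c {i k} → k ≢ i → c k ≤ fire G c i k
  fire-mono c {i} {k} k≢i rewrite fire-other c k≢i with adj G i k
  ... | true  = ℕP.n≤1+n (c k)
  ... | false = ℕP.≤-refl

  fire-local : ∀ c d i k → c k ≡ d k → fire G c i k ≡ fire G d i k
  fire-local c d i k = cong (λ z → if ⌊ k F.≟ i ⌋ then z ∸ deg G i else (if adj G i k then suc z else z))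

  Fires-congˡ : ∀ {c c′ d} → c ≗ c′ → Fires G c d → Fires G c′ d
  Fires-congˡ c≗c′ (done c≗d) = done (λ k → trans (sym (c≗c′ k)) (c≗d k))
  Fires-congˡ {c} {c′} c≗c′ (_∷ₛ_ {i = i} legal F) =
    subst (deg G i ≤_) (c≗c′ i) legal ∷ₛ Fires-congˡ (λ k → fire-local c c′ i k (c≗c′ k)) F

  Fires⁺ : Config n → Config n → Set
  Fires⁺ c d = Σ (Fin n) λ i → Legal G c i × Fires G (fire G c i) d

  Fires⁺-congˡ : ∀ {c c′ d} → c ≗ c′ → Fires⁺ c d → Fires⁺ c′ d
  Fires⁺-congˡ {c} {c′} c≗c′ (i , legal , F) =
    i , subst (deg G i ≤_) (c≗c′ i) legal , Fires-congˡ (λ k → fire-local c c′ i k (c≗c′ k)) F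

  Fires⁺⇒Fires : ∀ {c d} → Fires⁺ c d → Fires G c d
  Fires⁺⇒Fires (_ , legal , F) = legal ∷ₛ F

  Fires-trans : ∀ {c d e} → Fires G c d → Fires G d e → Fires G c e
  Fires-trans (done c≗d)  F′ = Fires-congˡ (sym ∘ c≗d) F′
  Fires-trans (legal ∷ₛ F) F′ = legal ∷ₛ Fires-trans F F′

  Fires⁺-trans : ∀ {c d e} → Fires⁺ c d → Fires G d e → Fires⁺ c e
  Fires⁺-trans (i , legal , F) F′ = i , legal , Fires-trans F F′

  Fired : ∀ {c d} → Fires G c d → Fin n → Set
  Fired (done _)           v = ⊥
  Fired (_∷ₛ_ {i = i} _ F) v = i ≡ v ⊎ Fired F v

  fired? : ∀ {c d} (F : Fires G c d) v → Dec (Fired F v)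
  fired? (done _)           v = no λ ()
  fired? (_∷ₛ_ {i = i} _ F) v with i F.≟ v | fired? F v
  ... | yes i≡v | _       = yes (inj₁ i≡v)
  ... | no _    | yes fv  = yes (inj₂ fv)
  ... | no i≢v  | no ¬fv  = no λ { (inj₁ i≡v) → i≢v i≡v ; (inj₂ fv) → ¬fv fv }

  unfired-gains : ∀ {c d} (F : Fires G c d) v → ¬ Fired F v →
    c v ≤ d v × (∀ {u} → Adj G u v → Fired F u → c v < d v)
  unfired-gains (done c≗d) v _ = ℕP.≤-reflexive (c≗d v) , λ _ ()
  unfired-gains {c} {d} (_∷ₛ_ {i = i} _ F) v ¬fv with unfired-gains F v (¬fv ∘ inj₂)
  ... | c′≤d , gains = ℕP.≤-trans (fire-mono c v≢i) c′≤d , gains′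
    where
    v≢i : v ≢ i
    v≢i v≡i = ¬fv (inj₁ (sym v≡i))
    gains′ : ∀ {u} → Adj G u v → i ≡ u ⊎ Fired F u → c v < d v
    gains′ uv (inj₁ refl) = ℕP.≤-trans (ℕP.≤-reflexive (sym (fire-adj c v≢i uv))) c′≤d
    gains′ uv (inj₂ fu)   = ℕP.≤-trans (s≤s (fire-mono c v≢i)) (gains uv fu)

  -- Along a walk from v to i, an unfired vertex next to a fired one would end with more chips than it began.
  returning-fires-everywhere : Connected G → ∀ {c i} (legal : Legal G c i) (F : Fires G (fire G c i) c) →
    ∀ v → Fired (legal ∷ₛ F) v
  returning-fires-everywhere connected {c} {i} legal F v = along (proj₂ (connected v i))
    where
    along : ∀ {x xs} → Walk G x i xs → Fired (legal ∷ₛ F) x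
    along here = inj₁ refl
    along {x} (step xz W) with fired? (legal ∷ₛ F) x
    ... | yes fx = fx
    ... | no ¬fx = ⊥-elim (ℕP.<-irrefl refl (proj₂ (unfired-gains (legal ∷ₛ F) x ¬fx) (Adj-sym G xz) (along W)))

fire-removeVertex : ∀ {n} (G : Graph (suc n)) j c a b → (b ≡ a → deg G (punchIn j a) ≡ deg (removeVertex G j) a) →
  fire G c (punchIn j a) (punchIn j b) ≡ fire (removeVertex G j) (removeAt c j) a b
fire-removeVertex G j c a b same-deg with b F.≟ a
... | yes refl = trans (Firing.fire-self G c (punchIn j a)) (cong (c (punchIn j a) ∸_) (same-deg refl))
... | no b≢a   = Firing.fire-other G c (b≢a ∘ FP.punchIn-injective j b a)

∸-suc-+-suc : ∀ x y d → suc d ≤ x → x ∸ suc d ℕ.+ suc y ∸ 1 ≡ x ℕ.+ y ∸ 1 ∸ d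
∸-suc-+-suc (suc x) y d (s≤s d≤x) = trans (cong (_∸ 1) (ℕP.+-suc (x ∸ d) y)) (sym (ℕP.+-∸-comm y d≤x))

if-suc-+-∸1 : ∀ b x y → 1 ≤ x ℕ.+ y →
  (if b then suc x else x) ℕ.+ y ∸ 1 ≡ (if b then suc (x ℕ.+ y ∸ 1) else x ℕ.+ y ∸ 1)
if-suc-+-∸1 true  x y 1≤ = sym (ℕP.suc-pred (x ℕ.+ y) {{ℕ.>-nonZero 1≤}})
if-suc-+-∸1 false x y _  = refl

if-suc-+ : ∀ b x y → (if b then suc x else x) ℕ.+ y ≡ (if b then suc (x ℕ.+ y) else x ℕ.+ y)
if-suc-+ true  x y = refl
if-suc-+ false x y = refl

+-[1∸s]-absorb : ∀ {s} x r → s ≤ 1 → s ℕ.+ (x ℕ.+ (1 ∸ s) ℕ.+ r) ≡ suc (x ℕ.+ r)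
+-[1∸s]-absorb x r z≤n       = cong (ℕ._+ r) (ℕP.+-comm x 1)
+-[1∸s]-absorb x r (s≤s z≤n) = cong (λ z → suc (z ℕ.+ r)) (ℕP.+-identityʳ x)

module LeafContraction {n} {G : Graph (suc (suc n))} (connected : Connected G) (L : Leaf G) where
  open LeafRemoval L public
  private
    module FG = Firing G
    module FT = Firing T′

  -- j and p are merged into p′, which loses the chip that the edge jp keeps in every
  -- self-reachable configuration.
  contract : Config (suc (suc n)) → Config (suc n)
  contract c = updateAt (removeAt c j) p′ (λ z → z ℕ.+ c j ∸ 1)

  contract-p′ : ∀ c → contract c p′ ≡ c p ℕ.+ c j ∸ 1
  contract-p′ c = VP.updateAt-updates p′ (removeAt c j)

  contract-other : ∀ c {a} → a ≢ p′ → contract c a ≡ c (punchIn j a)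
  contract-other c {a} a≢p′ = VP.updateAt-minimal a p′ (removeAt c j) a≢p′

  contract-cong : ∀ {c d} → c ≗ d → contract c ≗ contract d
  contract-cong {c} {d} c≗d = split-at p′
    (trans (contract-p′ c) (trans (cong₂ (λ x y → x ℕ.+ y ∸ 1) (c≗d p) (c≗d j)) (sym (contract-p′ d))))
    (λ a≢p′ → trans (contract-other c a≢p′) (trans (c≗d _) (sym (contract-other d a≢p′))))

  Contractible : Config (suc (suc n)) → Set
  Contractible c = 1 ≤ c p ℕ.+ c j

  sumℕ-contract : ∀ c → Contractible c → suc (sumℕ (contract c)) ≡ sumℕ c
  sumℕ-contract c 1≤ = begin
    suc (sumℕ (contract c))            ≡⟨ cong suc (sumℕ-updateAt (removeAt c j) p′ (λ z → z ℕ.+ c j ∸ 1)) ⟩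
    suc (c p ℕ.+ c j ∸ 1 ℕ.+ R)         ≡⟨ cong (ℕ._+ R) (ℕP.suc-pred (c p ℕ.+ c j) {{ℕ.>-nonZero 1≤}}) ⟩
    c p ℕ.+ c j ℕ.+ R                   ≡⟨ cong (ℕ._+ R) (ℕP.+-comm (c p) (c j)) ⟩
    c j ℕ.+ c p ℕ.+ R                   ≡⟨ ℕP.+-assoc (c j) (c p) R ⟩
    c j ℕ.+ (c p ℕ.+ R)                 ≡⟨ cong (c j ℕ.+_) (sumℕ-removeAt (removeAt c j) p′) ⟨
    c j ℕ.+ sumℕ (removeAt c j)         ≡⟨ sumℕ-removeAt c j ⟨
    sumℕ c                              ∎
    where
    open ≡-Reasoning
    R : ℕ
    R = sumℕ (removeAt (removeAt c j) p′)

  contract-fire-leaf : ∀ c → Legal G c j → contract (fire G c j) ≗ contract c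
  contract-fire-leaf c legal = split-at p′
    (begin
      contract (fire G c j) p′                        ≡⟨ contract-p′ (fire G c j) ⟩
      fire G c j p ℕ.+ fire G c j j ∸ 1               ≡⟨ cong₂ (λ x y → x ℕ.+ y ∸ 1) (FG.fire-adj c p≢j adj-neighbour)
                                                                                    (trans (FG.fire-self c j) (cong (c j ∸_) deg-leaf)) ⟩
      suc (c p) ℕ.+ (c j ∸ 1) ∸ 1                     ≡⟨ ℕP.+-∸-assoc (c p) (subst (_≤ c j) deg-leaf legal) ⟨
      c p ℕ.+ c j ∸ 1                                 ≡⟨ contract-p′ c ⟨
      contract c p′                                   ∎)
    (λ {a} a≢p′ → trans (contract-other (fire G c j) a≢p′)
      (trans (FG.fire-¬adj c (FP.punchInᵢ≢i j a) (¬adj-j (a≢p′ ∘ FP.punchIn-injective j a p′))) (sym (contract-other c a≢p′))))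
    where open ≡-Reasoning

  contract-fire-away : ∀ c a {b} → b ≢ p′ → (b ≡ a → deg G (punchIn j a) ≡ deg T′ a) →
    contract (fire G c (punchIn j a)) b ≡ fire T′ (contract c) a b
  contract-fire-away c a {b} b≢p′ same-deg = begin
    contract (fire G c (punchIn j a)) b         ≡⟨ contract-other (fire G c (punchIn j a)) b≢p′ ⟩
    fire G c (punchIn j a) (punchIn j b)        ≡⟨ fire-removeVertex G j c a b same-deg ⟩
    fire T′ (removeAt c j) a b                  ≡⟨ FT.fire-local (removeAt c j) (contract c) a b (sym (contract-other c b≢p′)) ⟩
    fire T′ (contract c) a b                    ∎
    where open ≡-Reasoning

  contract-fire : ∀ c a → Contractible c → Legal G c (punchIn j a) →
    Legal T′ (contract c) a × contract (fire G c (punchIn j a)) ≗ fire T′ (contract c) a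
  contract-fire c a 1≤ legal with a F.≟ p′
  ... | yes refl = legal′ , fire≗
    where
    1+d≤cp : suc (deg T′ p′) ≤ c p
    1+d≤cp = subst (_≤ c p) deg-neighbour legal
    legal′ : Legal T′ (contract c) p′
    legal′ = subst (deg T′ p′ ≤_) (sym (contract-p′ c))
                   (ℕP.∸-monoˡ-≤ 1 (ℕP.≤-trans 1+d≤cp (ℕP.m≤m+n (c p) (c j))))
    fire≗ : contract (fire G c p) ≗ fire T′ (contract c) p′
    fire≗ = split-at p′ at-p′ (λ b≢p′ → contract-fire-away c p′ b≢p′ (⊥-elim ∘ b≢p′))
      where
      at-p′ : contract (fire G c p) p′ ≡ fire T′ (contract c) p′ p′
      at-p′ = begin
        contract (fire G c p) p′                              ≡⟨ contract-p′ (fire G c p) ⟩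
        fire G c p p ℕ.+ fire G c p j ∸ 1                     ≡⟨ cong₂ (λ x y → x ℕ.+ y ∸ 1)
                                                                   (trans (FG.fire-self c p) (cong (c p ∸_) deg-neighbour))
                                                                   (FG.fire-adj c (p≢j ∘ sym) (Adj-sym G adj-neighbour)) ⟩
        c p ∸ suc (deg T′ p′) ℕ.+ suc (c j) ∸ 1              ≡⟨ ∸-suc-+-suc (c p) (c j) (deg T′ p′) 1+d≤cp ⟩
        c p ℕ.+ c j ∸ 1 ∸ deg T′ p′                           ≡⟨ cong (_∸ deg T′ p′) (contract-p′ c) ⟨
        contract c p′ ∸ deg T′ p′                             ≡⟨ FT.fire-self (contract c) p′ ⟨
        fire T′ (contract c) p′ p′                            ∎
        where open ≡-Reasoning
  ... | no a≢p′ = subst₂ _≤_ (deg-other a≢p′) (sym (contract-other c a≢p′)) legal , fire≗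
    where
    fire≗ : contract (fire G c (punchIn j a)) ≗ fire T′ (contract c) a
    fire≗ = split-at p′ at-p′ (λ b≢p′ → contract-fire-away c a b≢p′ (λ { refl → deg-other a≢p′ }))
      where
      at-p′ : contract (fire G c (punchIn j a)) p′ ≡ fire T′ (contract c) a p′
      at-p′ = begin
        contract (fire G c (punchIn j a)) p′                                    ≡⟨ contract-p′ (fire G c (punchIn j a)) ⟩
        fire G c (punchIn j a) p ℕ.+ fire G c (punchIn j a) j ∸ 1               ≡⟨ cong₂ (λ x y → x ℕ.+ y ∸ 1)
                                                                                     (FG.fire-other c (a≢p′ ∘ sym ∘ FP.punchIn-injective j p′ a))
                                                                                     (FG.fire-¬adj c (FP.punchInᵢ≢i j a ∘ sym) (¬adj-to-j a≢p′)) ⟩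
        (if adj T′ a p′ then suc (c p) else c p) ℕ.+ c j ∸ 1                    ≡⟨ if-suc-+-∸1 (adj T′ a p′) (c p) (c j) 1≤ ⟩
        (if adj T′ a p′ then suc (c p ℕ.+ c j ∸ 1) else c p ℕ.+ c j ∸ 1)        ≡⟨ cong (λ z → if adj T′ a p′ then suc z else z) (contract-p′ c) ⟨
        (if adj T′ a p′ then suc (contract c p′) else contract c p′)            ≡⟨ FT.fire-other (contract c) (a≢p′ ∘ sym) ⟨
        fire T′ (contract c) a p′                                               ∎
        where open ≡-Reasoning

  Contractible-fire-neighbour : ∀ c → Contractible (fire G c p)
  Contractible-fire-neighbour c =
    subst (λ z → 1 ≤ fire G c p p ℕ.+ z) (sym (FG.fire-adj c (p≢j ∘ sym) (Adj-sym G adj-neighbour)))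
          (ℕP.≤-trans (s≤s z≤n) (ℕP.m≤n+m (suc (c j)) (fire G c p p)))

  Contractible-fire : ∀ c i → Legal G c i → Contractible c → Contractible (fire G c i)
  Contractible-fire c i legal 1≤ with punchInView j i
  ... | at = subst (λ z → 1 ≤ z ℕ.+ fire G c j j) (sym (FG.fire-adj c p≢j adj-neighbour)) (s≤s z≤n)
  ... | punched a with a F.≟ p′
  ...   | yes refl = Contractible-fire-neighbour c
  ...   | no a≢p′  = ℕP.≤-trans 1≤ (ℕP.+-mono-≤ (FG.fire-mono c (a≢p′ ∘ sym ∘ FP.punchIn-injective j p′ a))
                                                 (FG.fire-mono c (FP.punchInᵢ≢i j a ∘ sym)))

  Fires-Contractible : ∀ {c d} → Fires G c d → Contractible c → Contractible d
  Fires-Contractible (done c≗d)                   1≤ = subst₂ (λ x y → 1 ≤ x ℕ.+ y) (c≗d p) (c≗d j) 1≤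
  Fires-Contractible {c} (_∷ₛ_ {i = i} legal F) 1≤ = Fires-Contractible F (Contractible-fire c i legal 1≤)

  fired-neighbour⇒Contractible : ∀ {c d} (F : Fires G c d) → FG.Fired F p → Contractible d
  fired-neighbour⇒Contractible {c} (_ ∷ₛ F) (inj₁ refl) = Fires-Contractible F (Contractible-fire-neighbour c)
  fired-neighbour⇒Contractible (_ ∷ₛ F)     (inj₂ fp)   = fired-neighbour⇒Contractible F fp

  contract-Fires : ∀ {c d} → Fires G c d → Contractible c → Fires T′ (contract c) (contract d)
  contract-Fires (done c≗d) _ = done (contract-cong c≗d)
  contract-Fires {c} (_∷ₛ_ {i = i} legal F) 1≤ with punchInView j i
  ... | at       = FT.Fires-congˡ (contract-fire-leaf c legal) (contract-Fires F (Contractible-fire c j legal 1≤))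
  ... | punched a with contract-fire c a 1≤ legal
  ...   | legal′ , fire≗ = legal′ ∷ₛ FT.Fires-congˡ fire≗ (contract-Fires F (Contractible-fire c _ legal 1≤))

  contract-Fires⁺ : ∀ {c d} (F : Fires G c d) → Contractible c → FG.Fired F p → FT.Fires⁺ (contract c) (contract d)
  contract-Fires⁺ (done _) _ ()
  contract-Fires⁺ {c} (_∷ₛ_ {i = i} legal F) 1≤ fp with punchInView j i | fp
  ... | at        | inj₁ j≡p = ⊥-elim (p≢j (sym j≡p))
  ... | at        | inj₂ fp′ =
    FT.Fires⁺-congˡ (contract-fire-leaf c legal) (contract-Fires⁺ F (Contractible-fire c j legal 1≤) fp′)
  ... | punched a | _ with contract-fire c a 1≤ legal
  ...   | legal′ , fire≗ = a , legal′ , FT.Fires-congˡ fire≗ (contract-Fires F (Contractible-fire c _ legal 1≤))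

  -- p fires somewhere in every returning firing sequence, and after that the edge jp carries a chip.
  SelfReachable⇒Contractible : ∀ {c} → SelfReachable G c → Contractible c
  SelfReachable⇒Contractible (i , legal , F) =
    fired-neighbour⇒Contractible (legal ∷ₛ F) (FG.returning-fires-everywhere connected legal F p)

  S-contract : ∀ {c} → S G (suc n) c → S T′ n (contract c)
  S-contract {c} (selfReachable@(i , legal , F) , ∑c) =
    contract-Fires⁺ (legal ∷ₛ F) 1≤ (FG.returning-fires-everywhere connected legal F p) ,
    ℕP.suc-injective (trans (sumℕ-contract c 1≤) ∑c)
    where
    1≤ : Contractible c
    1≤ = SelfReachable⇒Contractible selfReachable

  -- Inverse to contract on the configurations with s ≤ 1 chips on j.
  lift : ℕ → Config (suc n) → Config (suc (suc n))
  lift s c′ = insertAt (updateAt c′ p′ (ℕ._+ (1 ∸ s))) j s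

  lift-j : ∀ s c′ → lift s c′ j ≡ s
  lift-j s c′ = VP.insertAt-lookup _ j s

  lift-p : ∀ s c′ → lift s c′ p ≡ c′ p′ ℕ.+ (1 ∸ s)
  lift-p s c′ = trans (VP.insertAt-punchIn _ j s p′) (VP.updateAt-updates p′ c′)

  lift-other : ∀ s c′ {a} → a ≢ p′ → lift s c′ (punchIn j a) ≡ c′ a
  lift-other s c′ {a} a≢p′ = trans (VP.insertAt-punchIn _ j s a) (VP.updateAt-minimal a p′ c′ a≢p′)

  lift-cong : ∀ s {c′ d′} → c′ ≗ d′ → lift s c′ ≗ lift s d′
  lift-cong s {c′} {d′} c′≗d′ = by-coordinate
    (trans (lift-j s c′) (sym (lift-j s d′)))
    (trans (lift-p s c′) (trans (cong (ℕ._+ (1 ∸ s)) (c′≗d′ p′)) (sym (lift-p s d′))))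
    (λ a≢p′ → trans (lift-other s c′ a≢p′) (trans (c′≗d′ _) (sym (lift-other s d′ a≢p′))))

  sumℕ-lift : ∀ {s} c′ → s ≤ 1 → sumℕ (lift s c′) ≡ suc (sumℕ c′)
  sumℕ-lift {s} c′ s≤1 = begin
    sumℕ (lift s c′)                                         ≡⟨ sumℕ-insertAt _ j s ⟩
    s ℕ.+ sumℕ (updateAt c′ p′ (ℕ._+ (1 ∸ s)))               ≡⟨ cong (s ℕ.+_) (sumℕ-updateAt c′ p′ (ℕ._+ (1 ∸ s))) ⟩
    s ℕ.+ (c′ p′ ℕ.+ (1 ∸ s) ℕ.+ sumℕ (removeAt c′ p′))     ≡⟨ +-[1∸s]-absorb (c′ p′) (sumℕ (removeAt c′ p′)) s≤1 ⟩
    suc (c′ p′ ℕ.+ sumℕ (removeAt c′ p′))                     ≡⟨ cong suc (sumℕ-removeAt c′ p′) ⟨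
    suc (sumℕ c′)                                            ∎
    where open ≡-Reasoning

  fire-lift-away : ∀ s s′ c′ a {b} → b ≢ p′ → (b ≡ a → deg G (punchIn j a) ≡ deg T′ a) →
    fire G (lift s c′) (punchIn j a) (punchIn j b) ≡ lift s′ (fire T′ c′ a) (punchIn j b)
  fire-lift-away s s′ c′ a {b} b≢p′ same-deg = begin
    fire G (lift s c′) (punchIn j a) (punchIn j b)       ≡⟨ fire-removeVertex G j (lift s c′) a b same-deg ⟩
    fire T′ (removeAt (lift s c′) j) a b                 ≡⟨ FT.fire-local (removeAt (lift s c′) j) c′ a b (lift-other s c′ b≢p′) ⟩
    fire T′ c′ a b                                       ≡⟨ lift-other s′ (fire T′ c′ a) b≢p′ ⟨
    lift s′ (fire T′ c′ a) (punchIn j b)                 ∎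
    where open ≡-Reasoning

  fire-lift-other : ∀ s c′ {a} → a ≢ p′ → Legal T′ c′ a →
    Legal G (lift s c′) (punchIn j a) × fire G (lift s c′) (punchIn j a) ≗ lift s (fire T′ c′ a)
  fire-lift-other s c′ {a} a≢p′ legal = subst₂ _≤_ (sym (deg-other a≢p′)) (sym (lift-other s c′ a≢p′)) legal , fire≗
    where
    fire≗ : fire G (lift s c′) (punchIn j a) ≗ lift s (fire T′ c′ a)
    fire≗ = by-coordinate
      (trans (FG.fire-¬adj (lift s c′) (FP.punchInᵢ≢i j a ∘ sym) (¬adj-to-j a≢p′))
             (trans (lift-j s c′) (sym (lift-j s (fire T′ c′ a)))))
      at-p
      (λ b≢p′ → fire-lift-away s s c′ a b≢p′ (λ { refl → deg-other a≢p′ }))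
      where
      at-p : fire G (lift s c′) (punchIn j a) p ≡ lift s (fire T′ c′ a) p
      at-p = begin
        fire G (lift s c′) (punchIn j a) p                                          ≡⟨ FG.fire-other (lift s c′) (a≢p′ ∘ sym ∘ FP.punchIn-injective j p′ a) ⟩
        (if adj T′ a p′ then suc (lift s c′ p) else lift s c′ p)                   ≡⟨ cong (λ z → if adj T′ a p′ then suc z else z) (lift-p s c′) ⟩
        (if adj T′ a p′ then suc (c′ p′ ℕ.+ (1 ∸ s)) else c′ p′ ℕ.+ (1 ∸ s))      ≡⟨ if-suc-+ (adj T′ a p′) (c′ p′) (1 ∸ s) ⟨
        (if adj T′ a p′ then suc (c′ p′) else c′ p′) ℕ.+ (1 ∸ s)                  ≡⟨ cong (ℕ._+ (1 ∸ s)) (FT.fire-other c′ (a≢p′ ∘ sym)) ⟨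
        fire T′ c′ a p′ ℕ.+ (1 ∸ s)                                                ≡⟨ lift-p s (fire T′ c′ a) ⟨
        lift s (fire T′ c′ a) p                                                    ∎
        where open ≡-Reasoning

  fire-lift-leaf : ∀ c′ → Legal G (lift 1 c′) j × fire G (lift 1 c′) j ≗ lift 0 c′
  fire-lift-leaf c′ = subst₂ _≤_ (sym deg-leaf) (sym (lift-j 1 c′)) ℕP.≤-refl , fire≗
    where
    fire≗ : fire G (lift 1 c′) j ≗ lift 0 c′
    fire≗ = by-coordinate
      (trans (FG.fire-self (lift 1 c′) j) (trans (cong₂ _∸_ (lift-j 1 c′) deg-leaf) (sym (lift-j 0 c′))))
      (trans (FG.fire-adj (lift 1 c′) p≢j adj-neighbour)
             (trans (cong suc (trans (lift-p 1 c′) (ℕP.+-identityʳ (c′ p′))))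
                    (trans (ℕP.+-comm 1 (c′ p′)) (sym (lift-p 0 c′)))))
      (λ {b} b≢p′ → trans (FG.fire-¬adj (lift 1 c′) (FP.punchInᵢ≢i j b) (¬adj-j (b≢p′ ∘ FP.punchIn-injective j b p′)))
                          (trans (lift-other 1 c′ b≢p′) (sym (lift-other 0 c′ b≢p′))))

  fire-lift-neighbour : ∀ c′ → Legal T′ c′ p′ → Legal G (lift 0 c′) p × fire G (lift 0 c′) p ≗ lift 1 (fire T′ c′ p′)
  fire-lift-neighbour c′ legal = subst₂ _≤_ (sym deg-neighbour) (sym (trans (lift-p 0 c′) (ℕP.+-comm (c′ p′) 1))) (s≤s legal) , fire≗
    where
    fire≗ : fire G (lift 0 c′) p ≗ lift 1 (fire T′ c′ p′)
    fire≗ = by-coordinate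
      (trans (FG.fire-adj (lift 0 c′) (p≢j ∘ sym) (Adj-sym G adj-neighbour))
             (trans (cong suc (lift-j 0 c′)) (sym (lift-j 1 (fire T′ c′ p′)))))
      at-p
      (λ b≢p′ → fire-lift-away 0 1 c′ p′ b≢p′ (⊥-elim ∘ b≢p′))
      where
      at-p : fire G (lift 0 c′) p p ≡ lift 1 (fire T′ c′ p′) p
      at-p = begin
        fire G (lift 0 c′) p p                      ≡⟨ FG.fire-self (lift 0 c′) p ⟩
        lift 0 c′ p ∸ deg G p                       ≡⟨ cong₂ _∸_ (trans (lift-p 0 c′) (ℕP.+-comm (c′ p′) 1)) deg-neighbour ⟩
        c′ p′ ∸ deg T′ p′                           ≡⟨ FT.fire-self c′ p′ ⟨
        fire T′ c′ p′ p′                            ≡⟨ ℕP.+-identityʳ (fire T′ c′ p′ p′) ⟨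
        fire T′ c′ p′ p′ ℕ.+ (1 ∸ 1)                ≡⟨ lift-p 1 (fire T′ c′ p′) ⟨
        lift 1 (fire T′ c′ p′) p                    ∎
        where open ≡-Reasoning

  -- Firing p′ in T′ is simulated by firing j and p in G, in the order allowed by the chip on j.
  lift-fire : ∀ {s c′ a} → s ≤ 1 → Legal T′ c′ a → FG.Fires⁺ (lift s c′) (lift s (fire T′ c′ a))
  lift-fire {s} {c′} {a} s≤1 legal with a F.≟ p′ | s≤1
  ... | no a≢p′  | _ with fire-lift-other s c′ a≢p′ legal
  ...   | legal′ , fire≗ = punchIn j a , legal′ , done fire≗
  lift-fire {c′ = c′} _ legal | yes refl | z≤n with fire-lift-neighbour c′ legal | fire-lift-leaf (fire T′ c′ p′)
  ... | legalₚ , fire≗ₚ | legalⱼ , fire≗ⱼ =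
    p , legalₚ , FG.Fires-congˡ (sym ∘ fire≗ₚ) (legalⱼ ∷ₛ done fire≗ⱼ)
  lift-fire {c′ = c′} _ legal | yes refl | s≤s z≤n with fire-lift-leaf c′ | fire-lift-neighbour c′ legal
  ... | legalⱼ , fire≗ⱼ | legalₚ , fire≗ₚ =
    j , legalⱼ , FG.Fires-congˡ (sym ∘ fire≗ⱼ) (legalₚ ∷ₛ done fire≗ₚ)

  lift-Fires : ∀ {s c′ d′} → s ≤ 1 → Fires T′ c′ d′ → Fires G (lift s c′) (lift s d′)
  lift-Fires {s} _   (done c′≗d′)   = done (lift-cong s c′≗d′)
  lift-Fires     s≤1 (legal ∷ₛ F) = FG.Fires-trans (FG.Fires⁺⇒Fires (lift-fire s≤1 legal)) (lift-Fires s≤1 F)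

  S-lift : ∀ {s c′} → s ≤ 1 → S T′ n c′ → S G (suc n) (lift s c′)
  S-lift {c′ = c′} s≤1 ((a , legal , F) , ∑c′) =
    FG.Fires⁺-trans (lift-fire s≤1 legal) (lift-Fires s≤1 F) , trans (sumℕ-lift c′ s≤1) (cong suc ∑c′)

ℤtoℚ-+ : ∀ a b → ℤtoℚ (a ℤ.+ b) ≡ ℤtoℚ a ℚ.+ ℤtoℚ b
ℤtoℚ-+ a b = ℚP.toℚᵘ-injective (begin
  ℚ.toℚᵘ (ℤtoℚ (a ℤ.+ b))                        ≈⟨ ℚP.toℚᵘ-fromℚᵘ (ℚᵘ.mkℚᵘ (a ℤ.+ b) 0) ⟩
  ℚᵘ.mkℚᵘ (a ℤ.+ b) 0                            ≈⟨ ℚᵘ.*≡* (cong (ℤ._* + 1) (sym (cong₂ ℤ._+_ (ℤP.*-identityʳ a) (ℤP.*-identityʳ b)))) ⟩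
  ℚᵘ.mkℚᵘ a 0 ℚᵘ.+ ℚᵘ.mkℚᵘ b 0                  ≈⟨ ℚᵘP.+-cong (ℚP.toℚᵘ-fromℚᵘ (ℚᵘ.mkℚᵘ a 0)) (ℚP.toℚᵘ-fromℚᵘ (ℚᵘ.mkℚᵘ b 0)) ⟨
  ℚ.toℚᵘ (ℤtoℚ a) ℚᵘ.+ ℚ.toℚᵘ (ℤtoℚ b)          ≈⟨ ℚP.toℚᵘ-homo-+ (ℤtoℚ a) (ℤtoℚ b) ⟨
  ℚ.toℚᵘ (ℤtoℚ a ℚ.+ ℤtoℚ b)                     ∎)
  where open ℚᵘP.≃-Reasoning

ℤtoℚ-neg : ∀ a → ℤtoℚ (ℤ.- a) ≡ ℚ.- ℤtoℚ a
ℤtoℚ-neg a = ℚP.toℚᵘ-injective (begin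
  ℚ.toℚᵘ (ℤtoℚ (ℤ.- a))          ≈⟨ ℚP.toℚᵘ-fromℚᵘ (ℚᵘ.mkℚᵘ (ℤ.- a) 0) ⟩
  ℚᵘ.- ℚᵘ.mkℚᵘ a 0                ≈⟨ ℚᵘP.-‿cong (ℚP.toℚᵘ-fromℚᵘ (ℚᵘ.mkℚᵘ a 0)) ⟨
  ℚᵘ.- ℚ.toℚᵘ (ℤtoℚ a)            ≈⟨ ℚP.toℚᵘ-homo‿- (ℤtoℚ a) ⟨
  ℚ.toℚᵘ (ℚ.- ℤtoℚ a)             ∎)
  where open ℚᵘP.≃-Reasoning

ℤtoℚ-- : ∀ a b → ℤtoℚ (a ℤ.- b) ≡ ℤtoℚ a ℚ.- ℤtoℚ b
ℤtoℚ-- a b = trans (ℤtoℚ-+ a (ℤ.- b)) (cong (ℤtoℚ a ℚ.+_) (ℤtoℚ-neg b))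

ℕtoℚ-+ : ∀ a b → ℕtoℚ (a ℕ.+ b) ≡ ℕtoℚ a ℚ.+ ℕtoℚ b
ℕtoℚ-+ a b = ℤtoℚ-+ (+ a) (+ b)

ℕtoℚ-∸1 : ∀ {x} → 1 ≤ x → ℕtoℚ (x ∸ 1) ≡ ℕtoℚ x ℚ.- 1ℚ
ℕtoℚ-∸1 {suc y} _ = begin
  ℕtoℚ y                       ≡⟨ solve 1 (λ y → y := y :+ con 1ℚ :- con 1ℚ) refl (ℕtoℚ y) ⟩
  ℕtoℚ y ℚ.+ 1ℚ ℚ.- 1ℚ         ≡⟨ cong (ℚ._- 1ℚ) (ℕtoℚ-+ y 1) ⟨
  ℕtoℚ (y ℕ.+ 1) ℚ.- 1ℚ        ≡⟨ cong (λ z → ℕtoℚ z ℚ.- 1ℚ) (ℕP.+-comm y 1) ⟩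
  ℕtoℚ (suc y) ℚ.- 1ℚ          ∎
  where open ≡-Reasoning

ℕtoℚ-1∸ : ∀ {s} → s ≤ 1 → ℕtoℚ (1 ∸ s) ≡ 1ℚ ℚ.- ℕtoℚ s
ℕtoℚ-1∸ z≤n       = refl
ℕtoℚ-1∸ (s≤s z≤n) = refl

ℕtoℚ-∈[0,1] : ∀ {s} → s ≤ 1 → ℕtoℚ s ∈[0,1]
ℕtoℚ-∈[0,1] z≤n       = 0∈[0,1]
ℕtoℚ-∈[0,1] (s≤s z≤n) = 1∈[0,1]

sign-involutive : ∀ k x → sign k ℤ.* (sign k ℤ.* x) ≡ x
sign-involutive zero          x = trans (ℤP.*-identityˡ _) (ℤP.*-identityˡ x)
sign-involutive (suc zero)    x = trans (ℤP.-1*i≡-i (ℤ.-1ℤ ℤ.* x)) (trans (cong ℤ.-_ (ℤP.-1*i≡-i x)) (ℤP.neg-involutive x))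
sign-involutive (suc (suc k)) x = sign-involutive k x

signOffset : ℕ → ℤ
signOffset zero          = + 0
signOffset (suc zero)    = + 1
signOffset (suc (suc k)) = signOffset k

reflect : ℕ → ℚ → ℚ
reflect k t = ℤtoℚ (sign k) ℚ.* t ℚ.+ ℤtoℚ (signOffset k)

reflect-involutive : ∀ k t → reflect k (reflect k t) ≡ t
reflect-involutive zero          t = solve 1 (λ t → con 1ℚ :* (con 1ℚ :* t :+ con 0ℚ) :+ con 0ℚ := t) refl t
reflect-involutive (suc zero)    t = solve 1 (λ t → (:- con 1ℚ) :* ((:- con 1ℚ) :* t :+ con 1ℚ) :+ con 1ℚ := t) refl t
reflect-involutive (suc (suc k)) t = reflect-involutive k t

reflect-∈[0,1] : ∀ k {t} → t ∈[0,1] → reflect k t ∈[0,1]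
reflect-∈[0,1] zero          {t} t∈ = subst _∈[0,1] (solve 1 (λ t → t := con 1ℚ :* t :+ con 0ℚ) refl t) t∈
reflect-∈[0,1] (suc zero)    {t} t∈ = subst _∈[0,1] (solve 1 (λ t → con 1ℚ :- t := (:- con 1ℚ) :* t :+ con 1ℚ) refl t) (1-‿∈[0,1] t∈)
reflect-∈[0,1] (suc (suc k))     t∈ = reflect-∈[0,1] k t∈

det-cong : ∀ {n} {M N : Mat n} → (∀ r c → M r c ≡ N r c) → det M ≡ det N
det-cong {zero}  _   = refl
det-cong {suc n} M≡N = sumℤ-cong (λ c → cong₂ (λ x y → sign (toℕ c) ℤ.* (x ℤ.* y)) (M≡N zero c)
                                                  (det-cong (λ r c′ → M≡N (suc r) (punchIn c c′))))

affine-cong : ∀ {n} (U : Mat n) b {x y} → x ≗ y → affine U b x ≗ affine U b y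
affine-cong U b x≗y i = cong (ℚ._+ ℤtoℚ (b i)) (sumℚ-cong (λ k → cong (ℤtoℚ (U i k) ℚ.*_) (x≗y k)))

MapsOnto : ∀ {n} → Mat n → (Fin n → ℤ) → ((Fin n → ℚ) → Set) → ((Fin n → ℚ) → Set) → Set
MapsOnto {n} U b X Y = ∀ (y : Fin n → ℚ) →
  (Y y → Σ (Fin n → ℚ) λ x → X x × (∀ i → affine U b x i ≡ y i)) ×
  ((x : Fin n → ℚ) → X x → (∀ i → affine U b x i ≡ y i) → Y y)

module MergeCoordinates {n} (j : Fin (suc (suc n))) (p′ : Fin (suc n)) where
  open LeafCoordinates j p′

  contractℚ : (Fin (suc (suc n)) → ℚ) → Fin (suc n) → ℚ
  contractℚ x = updateAt (removeAt x j) p′ (λ z → z ℚ.+ x j ℚ.- 1ℚ)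

  liftℚ : ℚ → (Fin (suc n) → ℚ) → Fin (suc (suc n)) → ℚ
  liftℚ t x′ = insertAt (updateAt x′ p′ (ℚ._+ (1ℚ ℚ.- t))) j t

  liftℚ-j : ∀ t x′ → liftℚ t x′ j ≡ t
  liftℚ-j t x′ = VP.insertAt-lookup _ j t

  liftℚ-p : ∀ t x′ → liftℚ t x′ p ≡ x′ p′ ℚ.+ (1ℚ ℚ.- t)
  liftℚ-p t x′ = trans (VP.insertAt-punchIn _ j t p′) (VP.updateAt-updates p′ x′)

  liftℚ-other : ∀ t x′ {a} → a ≢ p′ → liftℚ t x′ (punchIn j a) ≡ x′ a
  liftℚ-other t x′ {a} a≢p′ = trans (VP.insertAt-punchIn _ j t a) (VP.updateAt-minimal a p′ x′ a≢p′)

  contractℚ-liftℚ : ∀ t x′ → contractℚ (liftℚ t x′) ≗ x′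
  contractℚ-liftℚ t x′ = split-at p′
    (begin
      contractℚ (liftℚ t x′) p′                          ≡⟨ VP.updateAt-updates p′ (removeAt (liftℚ t x′) j) ⟩
      liftℚ t x′ p ℚ.+ liftℚ t x′ j ℚ.- 1ℚ               ≡⟨ cong₂ (λ y z → y ℚ.+ z ℚ.- 1ℚ) (liftℚ-p t x′) (liftℚ-j t x′) ⟩
      x′ p′ ℚ.+ (1ℚ ℚ.- t) ℚ.+ t ℚ.- 1ℚ                  ≡⟨ solve 2 (λ x t → x :+ (con 1ℚ :- t) :+ t :- con 1ℚ := x) refl (x′ p′) t ⟩
      x′ p′                                              ∎)
    (λ a≢p′ → trans (VP.updateAt-minimal _ p′ (removeAt (liftℚ t x′) j) a≢p′) (liftℚ-other t x′ a≢p′))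
    where open ≡-Reasoning

  liftℚ-convex : ∀ t x′ → liftℚ t x′ ≗ (λ k → (1ℚ ℚ.- t) ℚ.* liftℚ 0ℚ x′ k ℚ.+ t ℚ.* liftℚ 1ℚ x′ k)
  liftℚ-convex t x′ = by-coordinate
    (begin
      liftℚ t x′ j                                                  ≡⟨ liftℚ-j t x′ ⟩
      t                                                             ≡⟨ solve 1 (λ t → t := (con 1ℚ :- t) :* con 0ℚ :+ t :* con 1ℚ) refl t ⟩
      (1ℚ ℚ.- t) ℚ.* 0ℚ ℚ.+ t ℚ.* 1ℚ                                ≡⟨ mix (liftℚ-j 0ℚ x′) (liftℚ-j 1ℚ x′) ⟨
      (1ℚ ℚ.- t) ℚ.* liftℚ 0ℚ x′ j ℚ.+ t ℚ.* liftℚ 1ℚ x′ j          ∎)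
    (begin
      liftℚ t x′ p                                                  ≡⟨ liftℚ-p t x′ ⟩
      x′ p′ ℚ.+ (1ℚ ℚ.- t)                                          ≡⟨ solve 2 (λ x t → x :+ (con 1ℚ :- t) :=
                                                                         (con 1ℚ :- t) :* (x :+ (con 1ℚ :- con 0ℚ)) :+ t :* (x :+ (con 1ℚ :- con 1ℚ)))
                                                                         refl (x′ p′) t ⟩
      (1ℚ ℚ.- t) ℚ.* (x′ p′ ℚ.+ (1ℚ ℚ.- 0ℚ)) ℚ.+ t ℚ.* (x′ p′ ℚ.+ (1ℚ ℚ.- 1ℚ))
                                                                    ≡⟨ mix (liftℚ-p 0ℚ x′) (liftℚ-p 1ℚ x′) ⟨
      (1ℚ ℚ.- t) ℚ.* liftℚ 0ℚ x′ p ℚ.+ t ℚ.* liftℚ 1ℚ x′ p          ∎)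
    (λ {a} a≢p′ → begin
      liftℚ t x′ (punchIn j a)                                      ≡⟨ liftℚ-other t x′ a≢p′ ⟩
      x′ a                                                          ≡⟨ solve 2 (λ x t → x := (con 1ℚ :- t) :* x :+ t :* x) refl (x′ a) t ⟩
      (1ℚ ℚ.- t) ℚ.* x′ a ℚ.+ t ℚ.* x′ a                            ≡⟨ mix (liftℚ-other 0ℚ x′ a≢p′) (liftℚ-other 1ℚ x′ a≢p′) ⟨
      (1ℚ ℚ.- t) ℚ.* liftℚ 0ℚ x′ (punchIn j a) ℚ.+ t ℚ.* liftℚ 1ℚ x′ (punchIn j a)   ∎)
    where
    open ≡-Reasoning
    mix : ∀ {u u′ v v′} → u ≡ u′ → v ≡ v′ → (1ℚ ℚ.- t) ℚ.* u ℚ.+ t ℚ.* v ≡ (1ℚ ℚ.- t) ℚ.* u′ ℚ.+ t ℚ.* v′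
    mix = cong₂ (λ u v → (1ℚ ℚ.- t) ℚ.* u ℚ.+ t ℚ.* v)

  -- The leaf coordinate is read off (possibly reflected, to keep the determinant 1) in row 0; the
  -- other rows apply U′ after merging column j into column p′.
  extendMatrix : Mat (suc n) → Mat (suc (suc n))
  extendMatrix U′ zero    = insertAt (λ _ → + 0) j (sign (toℕ j))
  extendMatrix U′ (suc r) = insertAt (U′ r) j (U′ r p′)

  extendOffset : Mat (suc n) → (Fin (suc n) → ℤ) → Fin (suc (suc n)) → ℤ
  extendOffset U′ b′ zero    = signOffset (toℕ j)
  extendOffset U′ b′ (suc r) = b′ r ℤ.- U′ r p′

  det-extendMatrix : ∀ U′ → det (extendMatrix U′) ≡ det U′
  det-extendMatrix U′ = begin
    det (extendMatrix U′)                                              ≡⟨ sumℤ-removeAt term j ⟩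
    sign (toℕ j) ℤ.* (U zero j ℤ.* det (minor U j)) ℤ.+ sumℤ (λ k → term (punchIn j k))
                                                                       ≡⟨ cong₂ ℤ._+_ (cong₂ (λ x y → sign (toℕ j) ℤ.* (x ℤ.* y)) (VP.insertAt-lookup _ j _) (det-cong minor≡))
                                                                                       (sumℤ-zero other≡0) ⟩
    sign (toℕ j) ℤ.* (sign (toℕ j) ℤ.* det U′) ℤ.+ + 0               ≡⟨ ℤP.+-identityʳ _ ⟩
    sign (toℕ j) ℤ.* (sign (toℕ j) ℤ.* det U′)                        ≡⟨ sign-involutive (toℕ j) (det U′) ⟩
    det U′                                                             ∎
    where
    open ≡-Reasoning
    U : Mat (suc (suc n))
    U = extendMatrix U′
    term : Fin (suc (suc n)) → ℤ
    term c = sign (toℕ c) ℤ.* (U zero c ℤ.* det (minor U c))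
    minor≡ : ∀ r c → minor U j r c ≡ U′ r c
    minor≡ r c = VP.insertAt-punchIn (U′ r) j _ c
    other≡0 : ∀ k → term (punchIn j k) ≡ + 0
    other≡0 k = trans (cong (λ x → sign (toℕ (punchIn j k)) ℤ.* (x ℤ.* det (minor U (punchIn j k)))) (VP.insertAt-punchIn _ j _ k))
                      (ℤP.*-zeroʳ (sign (toℕ (punchIn j k))))

  affine-extend-zero : ∀ U′ b′ x → affine (extendMatrix U′) (extendOffset U′ b′) x zero ≡ reflect (toℕ j) (x j)
  affine-extend-zero U′ b′ x = cong (ℚ._+ ℤtoℚ (signOffset (toℕ j))) (begin
    sumℚ (λ c → ℤtoℚ (extendMatrix U′ zero c) ℚ.* x c)                                  ≡⟨ sumℚ-removeAt (λ c → ℤtoℚ (extendMatrix U′ zero c) ℚ.* x c) j ⟩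
    ℤtoℚ (extendMatrix U′ zero j) ℚ.* x j ℚ.+ sumℚ (λ k → ℤtoℚ (extendMatrix U′ zero (punchIn j k)) ℚ.* x (punchIn j k))
                                                                                         ≡⟨ cong₂ ℚ._+_ (cong (λ z → ℤtoℚ z ℚ.* x j) (VP.insertAt-lookup (λ _ → + 0) j (sign (toℕ j))))
                                                                                                         (sumℚ-zero other≡0) ⟩
    ℤtoℚ (sign (toℕ j)) ℚ.* x j ℚ.+ 0ℚ                                                   ≡⟨ ℚP.+-identityʳ _ ⟩
    ℤtoℚ (sign (toℕ j)) ℚ.* x j                                                          ∎)
    where
    open ≡-Reasoning
    other≡0 : ∀ k → ℤtoℚ (extendMatrix U′ zero (punchIn j k)) ℚ.* x (punchIn j k) ≡ 0ℚ
    other≡0 k = trans (cong (λ z → ℤtoℚ z ℚ.* x (punchIn j k)) (VP.insertAt-punchIn (λ _ → + 0) j (sign (toℕ j)) k)) (ℚP.*-zeroˡ (x (punchIn j k)))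

  affine-extend-suc : ∀ U′ b′ x r → affine (extendMatrix U′) (extendOffset U′ b′) x (suc r) ≡ affine U′ b′ (contractℚ x) r
  affine-extend-suc U′ b′ x r = begin
    sumℚ (λ c → ℤtoℚ (extendMatrix U′ (suc r) c) ℚ.* x c) ℚ.+ ℤtoℚ (b′ r ℤ.- U′ r p′)
                                                             ≡⟨ cong₂ ℚ._+_ extended-sum (ℤtoℚ-- (b′ r) (U′ r p′)) ⟩
    u ℚ.* x j ℚ.+ (u ℚ.* x p ℚ.+ R) ℚ.+ (ℤtoℚ (b′ r) ℚ.- u)  ≡⟨ solve 5 (λ u xj xp R B → u :* xj :+ (u :* xp :+ R) :+ (B :- u) := u :* (xp :+ xj :- con 1ℚ) :+ R :+ B)
                                                                      refl u (x j) (x p) R (ℤtoℚ (b′ r)) ⟩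
    u ℚ.* (x p ℚ.+ x j ℚ.- 1ℚ) ℚ.+ R ℚ.+ ℤtoℚ (b′ r)        ≡⟨ cong (ℚ._+ ℤtoℚ (b′ r)) contracted-sum ⟨
    sumℚ (λ a → ℤtoℚ (U′ r a) ℚ.* contractℚ x a) ℚ.+ ℤtoℚ (b′ r)   ∎
    where
    open ≡-Reasoning
    u : ℚ
    u = ℤtoℚ (U′ r p′)
    R : ℚ
    R = sumℚ (λ k → ℤtoℚ (U′ r (punchIn p′ k)) ℚ.* x (punchIn j (punchIn p′ k)))
    extended-sum : sumℚ (λ c → ℤtoℚ (extendMatrix U′ (suc r) c) ℚ.* x c) ≡ u ℚ.* x j ℚ.+ (u ℚ.* x p ℚ.+ R)
    extended-sum = trans (sumℚ-removeAt (λ c → ℤtoℚ (extendMatrix U′ (suc r) c) ℚ.* x c) j)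
      (cong₂ ℚ._+_ (cong (λ z → ℤtoℚ z ℚ.* x j) (VP.insertAt-lookup (U′ r) j (U′ r p′)))
                   (trans (sumℚ-cong (λ a → cong (λ z → ℤtoℚ z ℚ.* x (punchIn j a)) (VP.insertAt-punchIn (U′ r) j (U′ r p′) a)))
                          (sumℚ-removeAt (λ a → ℤtoℚ (U′ r a) ℚ.* x (punchIn j a)) p′)))
    contracted-sum : sumℚ (λ a → ℤtoℚ (U′ r a) ℚ.* contractℚ x a) ≡ u ℚ.* (x p ℚ.+ x j ℚ.- 1ℚ) ℚ.+ R
    contracted-sum = trans (sumℚ-removeAt (λ a → ℤtoℚ (U′ r a) ℚ.* contractℚ x a) p′)
      (cong₂ ℚ._+_ (cong (u ℚ.*_) (VP.updateAt-updates p′ {f = λ z → z ℚ.+ x j ℚ.- 1ℚ} (removeAt x j)))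
                   (sumℚ-cong (λ k → cong (ℤtoℚ (U′ r (punchIn p′ k)) ℚ.*_)
                                          (VP.updateAt-minimal (punchIn p′ k) p′ {f = λ z → z ℚ.+ x j ℚ.- 1ℚ} (removeAt x j) (FP.punchInᵢ≢i p′ k)))))

module LeafPolytope {n} {G : Graph (suc (suc n))} (connected : Connected G) (L : Leaf G) where
  open LeafContraction connected L public
  open MergeCoordinates j p′ public

  ℕtoℚ-contract-p′ : ∀ c → Contractible c → ℕtoℚ (contract c p′) ≡ ℕtoℚ (c p) ℚ.+ ℕtoℚ (c j) ℚ.- 1ℚ
  ℕtoℚ-contract-p′ c 1≤ = trans (cong ℕtoℚ (contract-p′ c)) (trans (ℕtoℚ-∸1 1≤) (cong (ℚ._- 1ℚ) (ℕtoℚ-+ (c p) (c j))))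

  P-leaf∈[0,1] : (∀ {c} → S G (suc n) c → c j ≤ 1) → ∀ {x} → P G (suc n) x → x j ∈[0,1]
  P-leaf∈[0,1] chips≤1 (_ , w , pts , w≥0 , ∑w≡1 , pts∈S , x≡) =
    subst _∈[0,1] (sym (x≡ j)) (weighted-∈[0,1] (w≥0 , ∑w≡1) (λ i → ℕtoℚ-∈[0,1] (chips≤1 (pts∈S i))))

  P-contract : ∀ {x} → P G (suc n) x → P T′ n (contractℚ x)
  P-contract {x} (m , w , pts , w≥0 , ∑w≡1 , pts∈S , x≡) =
    m , w , contract ∘ pts , w≥0 , ∑w≡1 , S-contract ∘ pts∈S , split-at p′ at-p′ away
    where
    open ≡-Reasoning
    ptsₖ : Fin (suc (suc n)) → Fin m → ℚ
    ptsₖ k i = ℕtoℚ (pts i k)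
    contractible : ∀ i → Contractible (pts i)
    contractible i = SelfReachable⇒Contractible (proj₁ (pts∈S i))
    at-p′ : contractℚ x p′ ≡ weighted w (λ i → ℕtoℚ (contract (pts i) p′))
    at-p′ = begin
      contractℚ x p′                                                ≡⟨ VP.updateAt-updates p′ (removeAt x j) ⟩
      x p ℚ.+ x j ℚ.- 1ℚ                                            ≡⟨ cong₂ (λ y z → y ℚ.+ z ℚ.- 1ℚ) (x≡ p) (x≡ j) ⟩
      weighted w (ptsₖ p) ℚ.+ weighted w (ptsₖ j) ℚ.- 1ℚ            ≡⟨ cong (ℚ._- 1ℚ) (weighted-+ w (ptsₖ p) (ptsₖ j)) ⟨
      weighted w (λ i → ptsₖ p i ℚ.+ ptsₖ j i) ℚ.- 1ℚ               ≡⟨ weighted-+const w (λ i → ptsₖ p i ℚ.+ ptsₖ j i) (ℚ.- 1ℚ) ∑w≡1 ⟨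
      weighted w (λ i → ptsₖ p i ℚ.+ ptsₖ j i ℚ.- 1ℚ)               ≡⟨ sumℚ-cong (λ i → cong (w i ℚ.*_) (ℕtoℚ-contract-p′ (pts i) (contractible i))) ⟨
      weighted w (λ i → ℕtoℚ (contract (pts i) p′))                 ∎
    away : ∀ {a} → a ≢ p′ → contractℚ x a ≡ weighted w (λ i → ℕtoℚ (contract (pts i) a))
    away {a} a≢p′ = begin
      contractℚ x a                                  ≡⟨ VP.updateAt-minimal a p′ (removeAt x j) a≢p′ ⟩
      x (punchIn j a)                                ≡⟨ x≡ (punchIn j a) ⟩
      weighted w (ptsₖ (punchIn j a))                ≡⟨ sumℚ-cong (λ i → cong (λ z → w i ℚ.* ℕtoℚ z) (contract-other (pts i) a≢p′)) ⟨
      weighted w (λ i → ℕtoℚ (contract (pts i) a))   ∎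

  P-lift-vertex : ∀ {s x′} → s ≤ 1 → P T′ n x′ → P G (suc n) (liftℚ (ℕtoℚ s) x′)
  P-lift-vertex {s} {x′} s≤1 (m , w , pts , w≥0 , ∑w≡1 , pts∈S , x′≡) =
    m , w , lift s ∘ pts , w≥0 , ∑w≡1 , S-lift s≤1 ∘ pts∈S , lift≡
    where
    open ≡-Reasoning
    lift≡ : ∀ k → liftℚ (ℕtoℚ s) x′ k ≡ weighted w (λ i → ℕtoℚ (lift s (pts i) k))
    lift≡ = by-coordinate
      (begin
        liftℚ (ℕtoℚ s) x′ j                                         ≡⟨ liftℚ-j (ℕtoℚ s) x′ ⟩
        ℕtoℚ s                                                      ≡⟨ weighted-const w (ℕtoℚ s) ∑w≡1 ⟨
        weighted w (λ _ → ℕtoℚ s)                                   ≡⟨ sumℚ-cong (λ i → cong (λ z → w i ℚ.* ℕtoℚ z) (lift-j s (pts i))) ⟨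
        weighted w (λ i → ℕtoℚ (lift s (pts i) j))                  ∎)
      (begin
        liftℚ (ℕtoℚ s) x′ p                                         ≡⟨ liftℚ-p (ℕtoℚ s) x′ ⟩
        x′ p′ ℚ.+ (1ℚ ℚ.- ℕtoℚ s)                                   ≡⟨ cong₂ ℚ._+_ (x′≡ p′) (sym (ℕtoℚ-1∸ s≤1)) ⟩
        weighted w (λ i → ℕtoℚ (pts i p′)) ℚ.+ ℕtoℚ (1 ∸ s)         ≡⟨ weighted-+const w (λ i → ℕtoℚ (pts i p′)) (ℕtoℚ (1 ∸ s)) ∑w≡1 ⟨
        weighted w (λ i → ℕtoℚ (pts i p′) ℚ.+ ℕtoℚ (1 ∸ s))         ≡⟨ sumℚ-cong (λ i → cong (w i ℚ.*_) (trans (cong ℕtoℚ (lift-p s (pts i)))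
                                                                                                              (ℕtoℚ-+ (pts i p′) (1 ∸ s)))) ⟨
        weighted w (λ i → ℕtoℚ (lift s (pts i) p))                  ∎)
      (λ {a} a≢p′ → begin
        liftℚ (ℕtoℚ s) x′ (punchIn j a)                             ≡⟨ liftℚ-other (ℕtoℚ s) x′ a≢p′ ⟩
        x′ a                                                        ≡⟨ x′≡ a ⟩
        weighted w (λ i → ℕtoℚ (pts i a))                           ≡⟨ sumℚ-cong (λ i → cong (λ z → w i ℚ.* ℕtoℚ z) (lift-other s (pts i) a≢p′)) ⟨
        weighted w (λ i → ℕtoℚ (lift s (pts i) (punchIn j a)))      ∎)

  P-lift : ∀ {t x′} → t ∈[0,1] → P T′ n x′ → P G (suc n) (liftℚ t x′)
  P-lift {t} {x′} t∈[0,1] x′∈P =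
    InConv-cong {A = S G (suc n)} (sym ∘ liftℚ-convex t x′)
      (InConv-convex {A = S G (suc n)} (P-lift-vertex z≤n x′∈P) (P-lift-vertex (s≤s z≤n) x′∈P) t∈[0,1])

module _ {n} {G : Graph (suc (suc n))} (connected : Connected G) (L : Leaf G) where
  open LeafContraction connected L

  contract-≤deg⇒≤deg : ∀ {c} → Contractible c → (∀ a → contract c a ≤ deg T′ a) → ∀ a → c (punchIn j a) ≤ deg G (punchIn j a)
  contract-≤deg⇒≤deg {c} 1≤ bound = split-at p′
    (begin
      c p                          ≤⟨ ℕP.m≤m+n (c p) (c j) ⟩
      c p ℕ.+ c j                  ≡⟨ ℕP.suc-pred (c p ℕ.+ c j) {{ℕ.>-nonZero 1≤}} ⟨
      suc (c p ℕ.+ c j ∸ 1)        ≡⟨ cong suc (contract-p′ c) ⟨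
      suc (contract c p′)          ≤⟨ s≤s (bound p′) ⟩
      suc (deg T′ p′)              ≡⟨ deg-neighbour ⟨
      deg G p                      ∎)
    (λ a≢p′ → subst₂ _≤_ (contract-other c a≢p′) (sym (deg-other a≢p′)) (bound _))
    where open ℕP.≤-Reasoning

S⇒≤deg : ∀ m (T : Graph (suc m)) → IsTree T → ∀ {c} → S T m c → ∀ v → c v ≤ deg T v
S⇒≤deg zero T _ {c} (_ , ∑c≡0) v =
  ℕP.≤-trans (ℕP.≤-trans (ℕP.m≤m+n (c v) _) (ℕP.≤-reflexive (trans (sym (sumℕ-removeAt c v)) ∑c≡0))) z≤n
S⇒≤deg (suc m) T tree {c} c∈S v with tree-has-leaf-avoiding T tree v
... | L , j≢v with punchInView (Leaf.vertex L) v
...   | at        = ⊥-elim (j≢v refl)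
...   | punched a =
  contract-≤deg⇒≤deg (proj₁ tree) L {c} (SelfReachable⇒Contractible (proj₁ c∈S)) (S⇒≤deg m T′ (IsTree-removeLeaf tree) (S-contract c∈S)) a
  where open LeafContraction (proj₁ tree) L

CubeTimesZero-uncons : ∀ {m y} → CubeTimesZero (suc m) y → y zero ∈[0,1] × CubeTimesZero m (y ∘ suc)
CubeTimesZero-uncons cube = proj₁ (cube zero) (s≤s z≤n) , λ i → proj₁ (cube (suc i)) ∘ s≤s , proj₂ (cube (suc i)) ∘ cong suc

CubeTimesZero-cons : ∀ {m y} → y zero ∈[0,1] → CubeTimesZero m (y ∘ suc) → CubeTimesZero (suc m) y
CubeTimesZero-cons y₀∈ cube zero    = (λ _ → y₀∈) , λ ()
CubeTimesZero-cons y₀∈ cube (suc i) = (λ { (s≤s i<m) → proj₁ (cube i) i<m }) , proj₂ (cube i) ∘ ℕP.suc-injective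

MapsOnto-point : (T : Graph 1) → MapsOnto (λ _ _ → + 1) (λ _ → + 0) (P T 0) (CubeTimesZero 0)
MapsOnto-point T y = preimage , image
  where
  affine-id : ∀ x → affine (λ _ _ → + 1) (λ _ → + 0) x zero ≡ x zero
  affine-id x = solve 1 (λ x → con 1ℚ :* x :+ con 0ℚ :+ con 0ℚ := x) refl (x zero)
  deg≡0 : deg T zero ≡ 0
  deg≡0 = cong (λ b → indicator b ℕ.+ 0) (irrefl T zero)
  empty∈S : S T 0 (λ _ → 0)
  empty∈S = (zero , ℕP.≤-reflexive deg≡0 , done λ { zero → trans (Firing.fire-self T (λ _ → 0) zero) (ℕP.0∸n≡0 (deg T zero)) }) , refl
  preimage : CubeTimesZero 0 y → Σ (Fin 1 → ℚ) λ x → P T 0 x × (∀ i → affine (λ _ _ → + 1) (λ _ → + 0) x i ≡ y i)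
  preimage cube = (λ _ → 0ℚ) , (1 , (λ _ → 1ℚ) , (λ _ _ → 0) , (λ _ → 0≤1) , refl , (λ _ → empty∈S) , λ { zero → refl }) ,
                  λ { zero → sym (proj₂ (cube zero) refl) }
  image : (x : Fin 1 → ℚ) → P T 0 x → (∀ i → affine (λ _ _ → + 1) (λ _ → + 0) x i ≡ y i) → CubeTimesZero 0 y
  image x (_ , w , pts , _ , _ , pts∈S , x≡) x↦y zero = (λ ()) , λ _ → begin
    y zero                                   ≡⟨ trans (sym (x↦y zero)) (affine-id x) ⟩
    x zero                                   ≡⟨ x≡ zero ⟩
    weighted w (λ i → ℕtoℚ (pts i zero))     ≡⟨ sumℚ-zero (λ i → trans (cong (λ z → w i ℚ.* ℕtoℚ z) (no-chips i)) (ℚP.*-zeroʳ (w i))) ⟩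
    0ℚ                                       ∎
    where
    open ≡-Reasoning
    no-chips : ∀ i → pts i zero ≡ 0
    no-chips i = ℕP.m+n≡0⇒m≡0 (pts i zero) (proj₂ (pts∈S i))

module _ {m} {T : Graph (suc (suc m))} (connected : Connected T) (L : Leaf T) where
  open LeafPolytope connected L

  MapsOnto-extend : (∀ {c} → S T (suc m) c → c j ≤ 1) → ∀ {U′ b′} → MapsOnto U′ b′ (P T′ m) (CubeTimesZero m) →
    MapsOnto (extendMatrix U′) (extendOffset U′ b′) (P T (suc m)) (CubeTimesZero (suc m))
  MapsOnto-extend chips≤1 {U′} {b′} onto′ y = preimage , image
    where
    k : ℕ
    k = toℕ j
    preimage : CubeTimesZero (suc m) y →
      Σ (Fin (suc (suc m)) → ℚ) λ x → P T (suc m) x × (∀ i → affine (extendMatrix U′) (extendOffset U′ b′) x i ≡ y i)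
    preimage cube with CubeTimesZero-uncons cube
    ... | y₀∈ , cube′ with proj₁ (onto′ (y ∘ suc)) cube′
    ...   | x′ , x′∈P , x′↦ = liftℚ t x′ , P-lift (reflect-∈[0,1] k y₀∈) x′∈P , x↦
      where
      t : ℚ
      t = reflect k (y zero)
      x↦ : ∀ i → affine (extendMatrix U′) (extendOffset U′ b′) (liftℚ t x′) i ≡ y i
      x↦ zero    = trans (affine-extend-zero U′ b′ (liftℚ t x′)) (trans (cong (reflect k) (liftℚ-j t x′)) (reflect-involutive k (y zero)))
      x↦ (suc r) = trans (affine-extend-suc U′ b′ (liftℚ t x′) r) (trans (affine-cong U′ b′ (contractℚ-liftℚ t x′) r) (x′↦ r))
    image : (x : Fin (suc (suc m)) → ℚ) → P T (suc m) x → (∀ i → affine (extendMatrix U′) (extendOffset U′ b′) x i ≡ y i) →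
      CubeTimesZero (suc m) y
    image x x∈P x↦ =
      CubeTimesZero-cons (subst _∈[0,1] (trans (sym (affine-extend-zero U′ b′ x)) (x↦ zero)) (reflect-∈[0,1] k (P-leaf∈[0,1] chips≤1 x∈P)))
                         (proj₂ (onto′ (y ∘ suc)) (contractℚ x) (P-contract x∈P) (λ r → trans (sym (affine-extend-suc U′ b′ x r)) (x↦ (suc r))))

theorem3p4 : (m : ℕ) → (T : Graph (suc m)) → IsTree T →
    Σ (Mat (suc m)) λ U → Σ (Fin (suc m) → ℤ) λ b →
      (det U ≡ + 1) ×
      (∀ (y : Fin (suc m) → ℚ) →
        (CubeTimesZero m y → Σ (Fin (suc m) → ℚ) λ x → P T m x × (∀ i → affine U b x i ≡ y i)) ×
        ((x : Fin (suc m) → ℚ) → P T m x → (∀ i → affine U b x i ≡ y i) → CubeTimesZero m y))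
theorem3p4 zero    T _ = (λ _ _ → + 1) , (λ _ → + 0) , refl , MapsOnto-point T
theorem3p4 (suc m) T tree@(connected , _) with tree-has-leaf-avoiding T tree zero
... | L , _ with theorem3p4 m (LeafRemoval.T′ L) (LeafRemoval.IsTree-removeLeaf L tree)
...   | U′ , b′ , det≡1 , onto′ =
  extendMatrix U′ , extendOffset U′ b′ , trans (det-extendMatrix U′) det≡1 , MapsOnto-extend connected L chips≤1 onto′
  where
  open LeafPolytope connected L
  chips≤1 : ∀ {c} → S T (suc m) c → c j ≤ 1
  chips≤1 {c} c∈S = subst (c j ≤_) deg-leaf (S⇒≤deg (suc m) T tree c∈S j)
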